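{- Let $n>1$ be an odd integer. If $\mathcal{P}$ is an ideal path system of $C_{2n}$, then $\mathcal{P}$ is perfect, i.e., every path in $\mathcal{P}$ is a shortest path between its endpoints.
   Context: $C_m$ denotes the cycle with vertices $0,1,\dots,m-1$ and edges $\{i,i+1 \bmod m\}$. For a connected graph $G$, a path system of $G$ is a set consisting of one chosen path in $G$ connecting $a$ and $b$ for each unordered pair $\{a,b\}$ of distinct vertices. A global packing of $(G,\mathcal{P})$ is a map $\omega:\mathcal{P}\to\{1,\dots,k\}$ such that $\omega(P)\neq\omega(P')$ whenever distinct paths $P,P'\in\mathcal{P}$ share at least one edge; $\Phi(G,\mathcal{P})$ is the minimum such $k$, and $\Phi(G)$ is the minimum of $\Phi(G,\mathcal{P})$ over all path systems of $G$. A path system $\mathcal{P}$ is ideal if $\Phi(G,\mathcal{P})=\Phi(G)$; it is a shortest path system if each of its paths is a shortest path between its endpoints; it is perfect if it is both ideal and a shortest path system. -}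

module Defs where

open import Data.Nat using (ℕ; zero; suc; _+_; _*_; _≤_; _<_) public
open import Data.Fin using (Fin; toℕ) renaming (_<_ to _<ᶠ_) public
open import Data.List using (List; []; _∷_) public
open import Data.List.Membership.Propositional using (_∈_) public
open import Data.List.Relation.Unary.Unique.Propositional using (Unique) public
open import Data.Product using (Σ; ∃; ∃-syntax; _×_; _,_; proj₁; proj₂) public
open import Data.Sum using (_⊎_; inj₁; inj₂) public
open import Relation.Nullary using (¬_) public
open import Relation.Binary.PropositionalEquality using (_≡_; _≢_) public

record Graph : Set₁ where
  field
    N   : ℕ
    Adj : Fin N → Fin N → Set

open Graph public

CycSucc : (m : ℕ) → Fin m → Fin m → Set
CycSucc m i j = (suc (toℕ i) ≡ toℕ j) ⊎ (suc (toℕ i) ≡ m × toℕ j ≡ 0)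

C : ℕ → Graph
C m = record { N = m ; Adj = λ i j → CycSucc m i j ⊎ CycSucc m j i }

module _ (G : Graph) where

  data Walk : Fin (N G) → Fin (N G) → Set where
    stop : (a : Fin (N G)) → Walk a a
    step : (a : Fin (N G)) {b c : Fin (N G)} → Adj G a b → Walk b c → Walk a c

  vertices : ∀ {a b} → Walk a b → List (Fin (N G))
  vertices (stop a)       = a ∷ []
  vertices (step a _ w)   = a ∷ vertices w

  len : ∀ {a b} → Walk a b → ℕ
  len (stop _)     = 0
  len (step _ _ w) = suc (len w)

  edges : ∀ {a b} → Walk a b → List (Fin (N G) × Fin (N G))
  edges (stop _)                 = []
  edges (step a {b} _ w)         = (a , b) ∷ edges w

  Path : Fin (N G) → Fin (N G) → Set
  Path a b = Σ (Walk a b) (λ w → Unique (vertices w))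

  ShareEdge : ∀ {a b c d} → Path a b → Path c d → Set
  ShareEdge P Q = ∃[ u ] ∃[ v ]
    ((u , v) ∈ edges (proj₁ P) × ((u , v) ∈ edges (proj₁ Q) ⊎ (v , u) ∈ edges (proj₁ Q)))

  -- unordered pairs {a,b} of distinct vertices, represented as a < b
  Pair : Set
  Pair = Σ (Fin (N G) × Fin (N G)) (λ ab → proj₁ ab <ᶠ proj₂ ab)

  PathSystem : Set
  PathSystem = (p : Pair) → Path (proj₁ (proj₁ p)) (proj₂ (proj₁ p))

  GlobalPacking : PathSystem → ℕ → Set
  GlobalPacking 𝒫 k = Σ (Pair → Fin k) λ ω →
    ∀ p q → proj₁ p ≢ proj₁ q → ShareEdge (𝒫 p) (𝒫 q) → ω p ≢ ω q

  IsMin : (ℕ → Set) → ℕ → Set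
  IsMin S x = S x × (∀ y → S y → x ≤ y)

  PhiSys≡ : PathSystem → ℕ → Set
  PhiSys≡ 𝒫 k = IsMin (GlobalPacking 𝒫) k

  Phi≡ : ℕ → Set
  Phi≡ k = IsMin (λ j → ∃[ 𝒫 ] PhiSys≡ 𝒫 j) k

  Ideal : PathSystem → Set
  Ideal 𝒫 = ∃[ k ] (PhiSys≡ 𝒫 k × Phi≡ k)

  IsShortest : ∀ {a b} → Path a b → Set
  IsShortest {a} {b} P = ∀ (Q : Path a b) → len (proj₁ P) ≤ len (proj₁ Q)

  ShortestPathSystem : PathSystem → Set
  ShortestPathSystem 𝒫 = ∀ p → IsShortest (𝒫 p)

  Perfect : PathSystem → Set
  Perfect 𝒫 = Ideal 𝒫 × ShortestPathSystem 𝒫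

-- Let 𝒫 be a path system of C (2n) packed with k colours, and S the total length of its paths.
-- Paths of one colour are edge-disjoint, so each colour contributes at most 2 to the degree of a
-- vertex. A path's degree at a vertex has the parity of its number of ends there, and every
-- vertex ends 2n - 1 paths, so the total degree at each vertex is odd, hence at most 2k - 1;
-- summing over the vertices, 2S ≤ 2n(2k - 1). As S is at least the sum n³ of the cyclic
-- distances of all pairs, k ≥ (n² + 1)/2. Shortest arcs, antipodal pairs taken from their even
-- end, can be packed with (n² + 1)/2 colours, so this is Φ(C (2n)); for an ideal 𝒫 the two
-- bounds force S = n³, so every path of 𝒫 is a shortest path.

module Submission where

open import Defs
open import Data.Nat using (NonZero; s≤s; s≤s⁻¹; z≤n; _∸_; _⊓_; ∣_-_∣; _≟_; _<?_; _≤?_)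
open import Data.Nat.Properties
open import Data.Fin using (zero; suc; fromℕ<; _↑ˡ_; _↑ʳ_; splitAt; combine; remQuot)
import Data.Fin.Properties as Fin
open import Data.Empty using (⊥-elim)
open import Data.Product using (∃₂; uncurry)
open import Function using (_∘_)
open import Data.Nat.Tactic.RingSolver using (solve-∀)
open import Data.Nat.Divisibility using (_∣_; divides; ∣m+n∣m⇒∣n; %-presˡ-∣)
open import Data.Nat.DivMod using (_%_; _/_; m*[n/m]≡n; m%n<n; m<n⇒m%n≡m; %-distribˡ-+; m%n%n≡m%n; [m+n]%n≡m%n; m≤n⇒[n∸m]%m≡n%m; n%n≡0)
open import Data.List.Relation.Unary.Any using (here; there)
import Data.List.Relation.Unary.All as All
open import Data.List.Relation.Unary.AllPairs using ([]; _∷_)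
open import Relation.Nullary using (Dec; yes; no; contradiction)
open import Relation.Binary.Definitions using (tri<; tri≈; tri>)
open import Relation.Binary.PropositionalEquality
  using (refl; sym; trans; cong; cong₂; subst; subst₂; module ≡-Reasoning)
open import Algebra.Properties.Semiring.Sum +-*-semiring
  using (sum; sum-syntax; sum-cong-≗; ∑-distrib-+; ∑-comm; *-distribˡ-sum; *-distribʳ-sum)

-- Finite sums

indicator : ∀ {A : Set} → Dec A → ℕ
indicator (yes _) = 1
indicator (no _)  = 0

δ : ∀ {k} → Fin k → Fin k → ℕ
δ i j = indicator (i Fin.≟ j)

δ-refl : ∀ {k} (i : Fin k) → δ i i ≡ 1
δ-refl i with i Fin.≟ i
... | yes _ = refl
... | no i≢i = contradiction refl i≢i

δ-≢ : ∀ {k} {i j : Fin k} → i ≢ j → δ i j ≡ 0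
δ-≢ {i = i} {j} i≢j with i Fin.≟ j
... | yes i≡j = contradiction i≡j i≢j
... | no _ = refl

δ-sym : ∀ {k} (i j : Fin k) → δ i j ≡ δ j i
δ-sym i j with i Fin.≟ j
... | yes refl = sym (δ-refl i)
... | no i≢j = sym (δ-≢ (i≢j ∘ sym))

δ≤1 : ∀ {k} (i j : Fin k) → δ i j ≤ 1
δ≤1 i j with i Fin.≟ j
... | yes _ = ≤-refl
... | no _ = z≤n

δ*-pos : ∀ {k} {i j : Fin k} {x} → 0 < δ i j * x → i ≡ j × 0 < x
δ*-pos {i = i} {j} {x} pos with i Fin.≟ j
... | yes i≡j = i≡j , subst (0 <_) (+-identityʳ x) pos

∑-mono-≤ : ∀ {k} {f g : Fin k → ℕ} → (∀ i → f i ≤ g i) → sum f ≤ sum g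
∑-mono-≤ {zero} f≤g = z≤n
∑-mono-≤ {suc k} f≤g = +-mono-≤ (f≤g zero) (∑-mono-≤ (f≤g ∘ suc))

∑-const : ∀ k c → ∑[ i < k ] c ≡ k * c
∑-const zero c = refl
∑-const (suc k) c = cong (c +_) (∑-const k c)

∑-zero : ∀ {k} {f : Fin k → ℕ} → (∀ i → f i ≡ 0) → sum f ≡ 0
∑-zero {k} {f} f≡0 = trans (sum-cong-≗ f≡0) (trans (∑-const k 0) (*-zeroʳ k))

term≤∑ : ∀ {k} (f : Fin k → ℕ) i → f i ≤ sum f
term≤∑ f zero = m≤m+n _ _
term≤∑ f (suc i) = ≤-trans (term≤∑ (f ∘ suc) i) (m≤n+m _ _)

∑-single : ∀ {k} {f : Fin k → ℕ} i → (∀ j → j ≢ i → f j ≡ 0) → sum f ≡ f i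
∑-single {suc k} {f} zero off = trans (cong (f zero +_) (∑-zero (λ j → off (suc j) λ ()))) (+-identityʳ (f zero))
∑-single {suc k} (suc i) off =
  cong₂ _+_ (off zero λ ()) (∑-single i (λ j j≢i → off (suc j) (j≢i ∘ Fin.suc-injective)))

∑-pos : ∀ {k} (f : Fin k → ℕ) → 0 < sum f → ∃[ i ] 0 < f i
∑-pos {suc k} f pos with f zero in eq
... | suc _ = zero , subst (0 <_) (sym eq) (s≤s z≤n)
... | zero with ∑-pos (f ∘ suc) pos
...   | i , fi>0 = suc i , fi>0

∑-δ : ∀ {k} (i : Fin k) → ∑[ j < k ] δ i j ≡ 1
∑-δ i = trans (∑-single i (λ j j≢i → δ-≢ (j≢i ∘ sym))) (δ-refl i)

∑-δ-select : ∀ {k} (i : Fin k) (g : Fin k → ℕ) → ∑[ j < k ] (δ i j * g j) ≡ g i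
∑-δ-select i g = trans (∑-single i (λ j j≢i → cong (_* g j) (δ-≢ (j≢i ∘ sym))))
                       (trans (cong (_* g i) (δ-refl i)) (+-identityʳ (g i)))

double+odd≢double : ∀ a {e n} q → e + 1 ≡ n + n → a + a + e ≢ q + q
double+odd≢double a {e} {n} q e+1≡2n eq = even≢odd (a + n) q (begin
  2 * (a + n)          ≡⟨ regroup a n ⟩
  a + a + (n + n)      ≡⟨ cong (a + a +_) e+1≡2n ⟨
  a + a + (e + 1)      ≡⟨ +-assoc (a + a) e 1 ⟨
  a + a + e + 1        ≡⟨ cong (_+ 1) eq ⟩
  q + q + 1            ≡⟨ double-suc q ⟩
  suc (2 * q)          ∎)
  where
  open ≡-Reasoning
  regroup : ∀ a n → 2 * (a + n) ≡ a + a + (n + n)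
  regroup = solve-∀
  double-suc : ∀ q → q + q + 1 ≡ suc (2 * q)
  double-suc = solve-∀

+-double-cancel-≤ : ∀ {a b} → a + a ≤ b + b → a ≤ b
+-double-cancel-≤ {a} {b} 2a≤2b with a ≤? b
... | yes a≤b = a≤b
... | no a≰b = contradiction 2a≤2b (<⇒≱ (+-mono-< (≰⇒> a≰b) (≰⇒> a≰b)))

∑ℕ : ℕ → (ℕ → ℕ) → ℕ
∑ℕ zero    f = 0
∑ℕ (suc k) f = ∑ℕ k f + f k

∑ℕ-cong : ∀ k {f g : ℕ → ℕ} → (∀ i → i < k → f i ≡ g i) → ∑ℕ k f ≡ ∑ℕ k g
∑ℕ-cong zero    f≡g = refl
∑ℕ-cong (suc k) f≡g = cong₂ _+_ (∑ℕ-cong k λ i i<k → f≡g i (m<n⇒m<1+n i<k)) (f≡g k ≤-refl)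

∑ℕ-zero : ∀ k {f : ℕ → ℕ} → (∀ i → i < k → f i ≡ 0) → ∑ℕ k f ≡ 0
∑ℕ-zero k f≡0 = trans (∑ℕ-cong k f≡0) (zeros k)
  where
  zeros : ∀ k → ∑ℕ k (λ _ → 0) ≡ 0
  zeros zero    = refl
  zeros (suc k) = cong (_+ 0) (zeros k)

∑ℕ-distrib-+ : ∀ k (f g : ℕ → ℕ) → ∑ℕ k (λ i → f i + g i) ≡ ∑ℕ k f + ∑ℕ k g
∑ℕ-distrib-+ zero    f g = refl
∑ℕ-distrib-+ (suc k) f g = trans (cong (_+ (f k + g k)) (∑ℕ-distrib-+ k f g)) (shuffle (∑ℕ k f) (∑ℕ k g) (f k) (g k))
  where
  shuffle : ∀ p q r s → (p + q) + (r + s) ≡ (p + r) + (q + s)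
  shuffle = solve-∀

∑ℕ-*ˡ : ∀ k c (f : ℕ → ℕ) → ∑ℕ k (λ i → c * f i) ≡ c * ∑ℕ k f
∑ℕ-*ˡ zero    c f = sym (*-zeroʳ c)
∑ℕ-*ˡ (suc k) c f = trans (cong (_+ c * f k) (∑ℕ-*ˡ k c f)) (sym (*-distribˡ-+ c (∑ℕ k f) (f k)))

∑ℕ-head : ∀ k (f : ℕ → ℕ) → ∑ℕ (suc k) f ≡ f 0 + ∑ℕ k (f ∘ suc)
∑ℕ-head zero    f = +-comm 0 (f 0)
∑ℕ-head (suc k) f = trans (cong (_+ f (suc k)) (∑ℕ-head k f)) (+-assoc (f 0) _ _)

∑-toℕ : ∀ k (f : ℕ → ℕ) → ∑[ i < k ] f (toℕ i) ≡ ∑ℕ k f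
∑-toℕ zero    f = refl
∑-toℕ (suc k) f = trans (cong (f 0 +_) (∑-toℕ k (f ∘ suc))) (sym (∑ℕ-head k f))

∑ℕ-split : ∀ a b (f : ℕ → ℕ) → ∑ℕ (a + b) f ≡ ∑ℕ a f + ∑ℕ b (λ i → f (a + i))
∑ℕ-split a zero    f = trans (cong (λ k → ∑ℕ k f) (+-identityʳ a)) (sym (+-identityʳ _))
∑ℕ-split a (suc b) f = begin
  ∑ℕ (a + suc b) f                                    ≡⟨ cong (λ k → ∑ℕ k f) (+-suc a b) ⟩
  ∑ℕ (a + b) f + f (a + b)                            ≡⟨ cong (_+ f (a + b)) (∑ℕ-split a b f) ⟩
  ∑ℕ a f + ∑ℕ b (λ i → f (a + i)) + f (a + b)         ≡⟨ +-assoc (∑ℕ a f) _ _ ⟩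
  ∑ℕ a f + ∑ℕ (suc b) (λ i → f (a + i))               ∎
  where open ≡-Reasoning

∑ℕ-reverse : ∀ k (f : ℕ → ℕ) → ∑ℕ k (λ i → f (k ∸ suc i)) ≡ ∑ℕ k f
∑ℕ-reverse zero    f = refl
∑ℕ-reverse (suc k) f =
  trans (∑ℕ-head k _) (trans (+-comm (f k) _) (cong (_+ f k) (∑ℕ-reverse k f)))

∑ℕ-restrict : ∀ {k b} (f : ℕ → ℕ) → b ≤ k → ∑ℕ k (λ a → indicator (a <? b) * f a) ≡ ∑ℕ b f
∑ℕ-restrict {k} {b} f b≤k = begin
  ∑ℕ k g                                  ≡⟨ cong (λ k → ∑ℕ k g) (m+[n∸m]≡n b≤k) ⟨
  ∑ℕ (b + (k ∸ b)) g                      ≡⟨ ∑ℕ-split b (k ∸ b) g ⟩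
  ∑ℕ b g + ∑ℕ (k ∸ b) (λ i → g (b + i))  ≡⟨ cong₂ _+_ (∑ℕ-cong b (λ a → below)) (∑ℕ-zero (k ∸ b) (λ i _ → above (m≤m+n b i))) ⟩
  ∑ℕ b f + 0                              ≡⟨ +-identityʳ _ ⟩
  ∑ℕ b f                                  ∎
  where
  open ≡-Reasoning
  g : ℕ → ℕ
  g a = indicator (a <? b) * f a
  below : ∀ {a} → a < b → g a ≡ f a
  below {a} a<b with a <? b
  ... | yes _   = +-identityʳ (f a)
  ... | no a≮b  = contradiction a<b a≮b
  above : ∀ {a} → b ≤ a → g a ≡ 0
  above {a} b≤a with a <? b
  ... | yes a<b = contradiction a<b (≤⇒≯ b≤a)
  ... | no _    = refl

∑ℕ-triangle : ∀ k (h : ℕ → ℕ) → ∑ℕ k (λ b → ∑ℕ b h) ≡ ∑ℕ k (λ j → (k ∸ suc j) * h j)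
∑ℕ-triangle zero    h = refl
∑ℕ-triangle (suc k) h = begin
  ∑ℕ k (λ b → ∑ℕ b h) + ∑ℕ k h                        ≡⟨ cong (_+ ∑ℕ k h) (∑ℕ-triangle k h) ⟩
  ∑ℕ k (λ j → (k ∸ suc j) * h j) + ∑ℕ k h             ≡⟨ ∑ℕ-distrib-+ k _ h ⟨
  ∑ℕ k (λ j → (k ∸ suc j) * h j + h j)                ≡⟨ ∑ℕ-cong k (λ j j<k → trans (+-comm _ (h j))
                                                           (cong (_* h j) (sym (+-∸-assoc 1 j<k)))) ⟩
  ∑ℕ k (λ j → (suc k ∸ suc j) * h j)                  ≡⟨ +-identityʳ _ ⟨
  ∑ℕ k (λ j → (suc k ∸ suc j) * h j) + 0              ≡⟨ cong (∑ℕ k (λ j → (suc k ∸ suc j) * h j) +_)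
                                                           (cong (_* h k) (n∸n≡0 k)) ⟨
  ∑ℕ (suc k) (λ j → (suc k ∸ suc j) * h j)            ∎
  where open ≡-Reasoning

∑ℕ-odd : ∀ n → ∑ℕ n (λ j → 2 * j + 1) ≡ n * n
∑ℕ-odd zero    = refl
∑ℕ-odd (suc n) = trans (cong (_+ (2 * n + 1)) (∑ℕ-odd n)) (square-suc n)
  where
  square-suc : ∀ n → n * n + (2 * n + 1) ≡ suc n * suc n
  square-suc = solve-∀

∑ℕ-suc : ∀ n → 2 * ∑ℕ n suc ≡ n * suc n
∑ℕ-suc zero    = refl
∑ℕ-suc (suc n) = trans (*-distribˡ-+ 2 (∑ℕ n suc) (suc n)) (trans (cong (_+ 2 * suc n) (∑ℕ-suc n)) (factor n))
  where
  factor : ∀ n → n * suc n + 2 * suc n ≡ suc n * suc (suc n)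
  factor = solve-∀

private
  gap-term : ℕ → ℕ → ℕ
  gap-term n j = (n + n ∸ suc j) * (suc j ⊓ (n + n ∸ suc j))

  gap-term-near : ∀ n j → j < n → gap-term n j + j * j + (2 * j + 1) ≡ (n + n) * suc j
  gap-term-near n j j<n = begin
    gap-term n j + j * j + (2 * j + 1)                    ≡⟨ cong (λ x → (n + n ∸ suc j) * x + j * j + (2 * j + 1))
                                                               (m≤n⇒m⊓n≡m (≤-trans j<n (≤-trans (m≤n+m n (n ∸ suc j))
                                                                 (≤-reflexive (sym (+-∸-comm n j<n)))))) ⟩
    (n + n ∸ suc j) * suc j + j * j + (2 * j + 1)         ≡⟨ complete (n + n ∸ suc j) j ⟩
    (n + n ∸ suc j + suc j) * suc j                       ≡⟨ cong (_* suc j) (m∸n+n≡m (≤-trans j<n (m≤m+n n n))) ⟩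
    (n + n) * suc j                                       ∎
    where
    open ≡-Reasoning
    complete : ∀ d j → d * suc j + j * j + (2 * j + 1) ≡ (d + suc j) * suc j
    complete = solve-∀

  gap-term-far : ∀ n i → i < n → gap-term n (n + i) ≡ (n ∸ suc i) * (n ∸ suc i)
  gap-term-far n i i<n = begin
    (n + n ∸ suc (n + i)) * (suc (n + i) ⊓ (n + n ∸ suc (n + i)))
      ≡⟨ cong (λ x → (n + n ∸ x) * (suc (n + i) ⊓ (n + n ∸ x))) (sym (+-suc n i)) ⟩
    (n + n ∸ (n + suc i)) * (suc (n + i) ⊓ (n + n ∸ (n + suc i)))
      ≡⟨ cong (λ x → x * (suc (n + i) ⊓ x)) ([m+n]∸[m+o]≡n∸o n n (suc i)) ⟩
    (n ∸ suc i) * (suc (n + i) ⊓ (n ∸ suc i))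
      ≡⟨ cong ((n ∸ suc i) *_) (m≥n⇒m⊓n≡n (≤-trans (m∸n≤m n (suc i)) (≤-trans (m≤m+n n i) (n≤1+n _)))) ⟩
    (n ∸ suc i) * (n ∸ suc i) ∎
    where open ≡-Reasoning

-- Summing over the gap j + 1 = b - a between the two vertices of a pair:
-- there are 2n - (j + 1) pairs with that gap, each at cyclic distance (j + 1) ⊓ (2n - (j + 1)).
∑ℕ-cyclic-gaps : ∀ n → ∑ℕ (n + n) (gap-term n) ≡ n * n * n
∑ℕ-cyclic-gaps n = +-cancelʳ-≡ (n * n) _ _ (begin
  ∑ℕ (n + n) (gap-term n) + n * n
    ≡⟨ cong₂ _+_ (∑ℕ-split n n (gap-term n)) (sym (∑ℕ-odd n)) ⟩
  ∑ℕ n (gap-term n) + ∑ℕ n (λ i → gap-term n (n + i)) + ∑ℕ n (λ j → 2 * j + 1)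
    ≡⟨ cong (λ x → ∑ℕ n (gap-term n) + x + ∑ℕ n (λ j → 2 * j + 1))
            (trans (∑ℕ-cong n (gap-term-far n)) (∑ℕ-reverse n (λ j → j * j))) ⟩
  ∑ℕ n (gap-term n) + ∑ℕ n (λ j → j * j) + ∑ℕ n (λ j → 2 * j + 1)
    ≡⟨ trans (∑ℕ-distrib-+ n (λ j → gap-term n j + j * j) (λ j → 2 * j + 1))
             (cong (_+ ∑ℕ n (λ j → 2 * j + 1)) (∑ℕ-distrib-+ n (gap-term n) (λ j → j * j))) ⟨
  ∑ℕ n (λ j → gap-term n j + j * j + (2 * j + 1))
    ≡⟨ ∑ℕ-cong n (gap-term-near n) ⟩
  ∑ℕ n (λ j → (n + n) * suc j)
    ≡⟨ ∑ℕ-*ˡ n (n + n) suc ⟩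
  (n + n) * ∑ℕ n suc
    ≡⟨ regroup n (∑ℕ n suc) ⟩
  n * (2 * ∑ℕ n suc)
    ≡⟨ cong (n *_) (∑ℕ-suc n) ⟩
  n * (n * suc n)
    ≡⟨ expand n ⟩
  n * n * n + n * n ∎)
  where
  open ≡-Reasoning
  regroup : ∀ n s → (n + n) * s ≡ n * (2 * s)
  regroup = solve-∀
  expand : ∀ n → n * (n * suc n) ≡ n * n * n + n * n
  expand = solve-∀
module PairSums (G : Graph) where

  restrict : ∀ {A : Set} → Dec A → (A → ℕ) → ℕ
  restrict (yes a) f = f a
  restrict (no _)  _ = 0

  ∑ᴾ : (Pair G → ℕ) → ℕ
  ∑ᴾ f = ∑[ a < N G ] ∑[ b < N G ] restrict (a Fin.<? b) (λ a<b → f ((a , b) , a<b))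

  private
    lift : (R : ℕ → ℕ → Set) → R 0 0 → {f g : Pair G → ℕ} → (∀ p → R (f p) (g p)) →
           ∀ a b → R (restrict (a Fin.<? b) (λ a<b → f ((a , b) , a<b)))
                     (restrict (a Fin.<? b) (λ a<b → g ((a , b) , a<b)))
    lift R r00 fRg a b with a Fin.<? b
    ... | yes a<b = fRg _
    ... | no _    = r00

  ∑ᴾ-cong : ∀ {f g : Pair G → ℕ} → (∀ p → f p ≡ g p) → ∑ᴾ f ≡ ∑ᴾ g
  ∑ᴾ-cong f≡g = sum-cong-≗ λ a → sum-cong-≗ (lift _≡_ refl f≡g a)

  ∑ᴾ-mono-≤ : ∀ {f g : Pair G → ℕ} → (∀ p → f p ≤ g p) → ∑ᴾ f ≤ ∑ᴾ g
  ∑ᴾ-mono-≤ f≤g = ∑-mono-≤ λ a → ∑-mono-≤ (lift _≤_ z≤n f≤g a)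

  ∑ᴾ-distrib-+ : ∀ (f g : Pair G → ℕ) → ∑ᴾ (λ p → f p + g p) ≡ ∑ᴾ f + ∑ᴾ g
  ∑ᴾ-distrib-+ f g = trans (sum-cong-≗ λ a → trans (sum-cong-≗ (split a)) (∑-distrib-+ (row f a) (row g a)))
                           (∑-distrib-+ (sum ∘ row f) (sum ∘ row g))
    where
    row : (Pair G → ℕ) → Fin (N G) → Fin (N G) → ℕ
    row h a b = restrict (a Fin.<? b) (λ a<b → h ((a , b) , a<b))
    split : ∀ a b → restrict (a Fin.<? b) (λ a<b → f ((a , b) , a<b) + g ((a , b) , a<b))
                  ≡ restrict (a Fin.<? b) (λ a<b → f ((a , b) , a<b))
                    + restrict (a Fin.<? b) (λ a<b → g ((a , b) , a<b))
    split a b with a Fin.<? b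
    ... | yes _ = refl
    ... | no _  = refl

  ∑ᴾ-comm : ∀ {k} (f : Pair G → Fin k → ℕ) → ∑ᴾ (λ p → ∑[ c < k ] f p c) ≡ ∑[ c < k ] ∑ᴾ (λ p → f p c)
  ∑ᴾ-comm {k} f = trans (sum-cong-≗ λ a → trans (sum-cong-≗ (swap a)) (∑-comm (entry a)))
                        (∑-comm λ a c → ∑[ b < N G ] entry a b c)
    where
    entry : Fin (N G) → Fin (N G) → Fin k → ℕ
    entry a b c = restrict (a Fin.<? b) (λ a<b → f ((a , b) , a<b) c)
    swap : ∀ a b → restrict (a Fin.<? b) (λ a<b → ∑[ c < k ] f ((a , b) , a<b) c)
                 ≡ ∑[ c < k ] restrict (a Fin.<? b) (λ a<b → f ((a , b) , a<b) c)
    swap a b with a Fin.<? b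
    ... | yes _ = refl
    ... | no _  = sym (∑-zero {k} λ _ → refl)

  private
    restrict-at : ∀ (f : Pair G → ℕ) (p : Pair G) →
      restrict (proj₁ (proj₁ p) Fin.<? proj₂ (proj₁ p)) (λ a<b → f (proj₁ p , a<b)) ≡ f p
    restrict-at f ((a , b) , a<b) with a Fin.<? b
    ... | yes a<b′ = cong (λ lt → f ((a , b) , lt)) (Fin.<-irrelevant a<b′ a<b)
    ... | no a≮b   = contradiction a<b a≮b

  term≤∑ᴾ : ∀ (f : Pair G → ℕ) p → f p ≤ ∑ᴾ f
  term≤∑ᴾ f p@((a , b) , _) = begin
    f p                  ≡⟨ restrict-at f p ⟨
    _                    ≤⟨ term≤∑ (λ b → restrict (a Fin.<? b) _) b ⟩
    _                    ≤⟨ term≤∑ (λ a → ∑[ b < N G ] restrict (a Fin.<? b) _) a ⟩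
    ∑ᴾ f                 ∎
    where open ≤-Reasoning

  ∑ᴾ-pos : ∀ (f : Pair G → ℕ) → 0 < ∑ᴾ f → ∃[ p ] 0 < f p
  ∑ᴾ-pos f pos with ∑-pos _ pos
  ... | a , inner with ∑-pos _ inner
  ...   | b , term = restrict-pos (a Fin.<? b) term
    where
    restrict-pos : ∀ {a b} (d : Dec (a <ᶠ b)) → 0 < restrict d (λ a<b → f ((a , b) , a<b)) →
                   ∃[ p ] 0 < f p
    restrict-pos (yes a<b) pos = _ , pos

  ∑ᴾ-single : ∀ {f : Pair G → ℕ} p → (∀ q → proj₁ q ≢ proj₁ p → f q ≡ 0) → ∑ᴾ f ≡ f p
  ∑ᴾ-single {f} p@((a₀ , b₀) , _) off = begin
    ∑ᴾ f                                             ≡⟨ ∑-single a₀ (λ a a≢a₀ → ∑-zero (outside-row a a≢a₀)) ⟩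
    ∑[ b < N G ] restrict (a₀ Fin.<? b) _           ≡⟨ ∑-single b₀ (outside-column a₀) ⟩
    restrict (a₀ Fin.<? b₀) _                       ≡⟨ restrict-at f p ⟩
    f p                                              ∎
    where
    open ≡-Reasoning
    outside-row : ∀ a → a ≢ a₀ → ∀ b → restrict (a Fin.<? b) (λ a<b → f ((a , b) , a<b)) ≡ 0
    outside-row a a≢a₀ b with a Fin.<? b
    ... | yes a<b = off ((a , b) , a<b) (a≢a₀ ∘ cong proj₁)
    ... | no _    = refl
    outside-column : ∀ a → ∀ b → b ≢ b₀ → restrict (a Fin.<? b) (λ a<b → f ((a , b) , a<b)) ≡ 0
    outside-column a b b≢b₀ with a Fin.<? b
    ... | yes a<b = off ((a , b) , a<b) (b≢b₀ ∘ cong proj₂)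
    ... | no _    = refl

  ∑ᴾ-tight : ∀ {f g : Pair G → ℕ} → (∀ p → f p ≤ g p) → ∑ᴾ g ≤ ∑ᴾ f → ∀ p → g p ≤ f p
  ∑ᴾ-tight {f} {g} f≤g ∑g≤∑f p with g p ≤? f p
  ... | yes gp≤fp = gp≤fp
  ... | no gp≰fp = contradiction ∑g≤∑f (<⇒≱ ∑f<∑g)
    where
    open ≤-Reasoning
    ∑f<∑g : ∑ᴾ f < ∑ᴾ g
    ∑f<∑g = begin-strict
      ∑ᴾ f                              ≡⟨ +-identityʳ (∑ᴾ f) ⟨
      ∑ᴾ f + 0                          <⟨ +-monoʳ-< (∑ᴾ f) (<-≤-trans (m<n⇒0<n∸m (≰⇒> gp≰fp))
                                                                (term≤∑ᴾ (λ q → g q ∸ f q) p)) ⟩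
      ∑ᴾ f + ∑ᴾ (λ q → g q ∸ f q)       ≡⟨ ∑ᴾ-distrib-+ f (λ q → g q ∸ f q) ⟨
      ∑ᴾ (λ q → f q + (g q ∸ f q))      ≡⟨ ∑ᴾ-cong (λ q → m+[n∸m]≡n (f≤g q)) ⟩
      ∑ᴾ g                              ∎

-- The cycle C m

module Modular (m : ℕ) ⦃ _ : NonZero m ⦄ where

  %-absorbˡ : ∀ x y → (x % m + y) % m ≡ (x + y) % m
  %-absorbˡ x y = begin
    (x % m + y) % m          ≡⟨ %-distribˡ-+ (x % m) y m ⟩
    (x % m % m + y % m) % m  ≡⟨ cong (λ r → (r + y % m) % m) (m%n%n≡m%n x m) ⟩
    (x % m + y % m) % m      ≡⟨ %-distribˡ-+ x y m ⟨
    (x + y) % m              ∎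
    where open ≡-Reasoning

  %-absorbʳ : ∀ x y → (y + x % m) % m ≡ (y + x) % m
  %-absorbʳ x y = trans (cong (_% m) (+-comm y (x % m)))
                        (trans (%-absorbˡ x y) (cong (_% m) (+-comm x y)))

  %-shift-≢ : ∀ x {d} → 0 < d → d < m → (x + d) % m ≢ x % m
  %-shift-≢ x {d} 0<d d<m eq with x % m + d <? m
  ... | yes small = <-irrefl (sym eq′) (m<m+n r 0<d)
    where
    r = x % m
    eq′ : r + d ≡ r
    eq′ = trans (sym (m<n⇒m%n≡m small)) (trans (%-absorbˡ x d) eq)
  ... | no big = <-irrefl d≡m d<m
    where
    r = x % m
    m≤r+d = ≮⇒≥ big
    wrapped : r + d ∸ m ≡ r
    wrapped = begin
      r + d ∸ m        ≡⟨ m<n⇒m%n≡m (+-cancelʳ-< m (r + d ∸ m) m below) ⟨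
      (r + d ∸ m) % m  ≡⟨ m≤n⇒[n∸m]%m≡n%m m≤r+d ⟩
      (r + d) % m      ≡⟨ trans (%-absorbˡ x d) eq ⟩
      r                ∎
      where
      open ≡-Reasoning
      below : r + d ∸ m + m < m + m
      below = subst (_< m + m) (sym (m∸n+n≡m m≤r+d)) (+-mono-< (m%n<n x m) d<m)
    d≡m : d ≡ m
    d≡m = +-cancelˡ-≡ r d m (trans (sym (m∸n+n≡m m≤r+d)) (cong (_+ m) wrapped))

module Cycle (m : ℕ) ⦃ _ : NonZero m ⦄ (3≤m : 3 ≤ m) where

  G : Graph
  G = C m

  open Modular m public

  vertex : ℕ → Fin m
  vertex x = fromℕ< (m%n<n x m)

  toℕ-vertex : ∀ x → toℕ (vertex x) ≡ x % m
  toℕ-vertex x = Fin.toℕ-fromℕ< (m%n<n x m)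

  vertex-cong : ∀ {x y} → x % m ≡ y % m → vertex x ≡ vertex y
  vertex-cong {x} {y} eq = Fin.toℕ-injective (trans (toℕ-vertex x) (trans eq (sym (toℕ-vertex y))))

  vertex-injective : ∀ {x y} → vertex x ≡ vertex y → x % m ≡ y % m
  vertex-injective {x} {y} eq = trans (sym (toℕ-vertex x)) (trans (cong toℕ eq) (toℕ-vertex y))

  vertex-toℕ : ∀ a → vertex (toℕ a) ≡ a
  vertex-toℕ a = Fin.toℕ-injective (trans (toℕ-vertex (toℕ a)) (m<n⇒m%n≡m (Fin.toℕ<n a)))

  vertex-+m : ∀ x → vertex (x + m) ≡ vertex x
  vertex-+m x = vertex-cong ([m+n]%n≡m%n x m)

  next : Fin m → Fin m
  next a = vertex (suc (toℕ a))

  prev : Fin m → Fin m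
  prev a = vertex (toℕ a + (m ∸ 1))

  next-vertex : ∀ x → next (vertex x) ≡ vertex (suc x)
  next-vertex x = trans (cong (vertex ∘ suc) (toℕ-vertex x)) (vertex-cong (%-absorbʳ x 1))

  private
    1+[m∸1]≡m : suc (m ∸ 1) ≡ m
    1+[m∸1]≡m = m+[n∸m]≡n (≤-trans (s≤s z≤n) 3≤m)

    a+1+[m∸1]≡a+m : ∀ {a} → suc (a + (m ∸ 1)) ≡ a + m
    a+1+[m∸1]≡a+m {a} = trans (sym (+-suc a (m ∸ 1))) (cong (a +_) 1+[m∸1]≡m)

  next-prev : ∀ a → next (prev a) ≡ a
  next-prev a = begin
    next (prev a)                     ≡⟨ next-vertex (toℕ a + (m ∸ 1)) ⟩
    vertex (suc (toℕ a + (m ∸ 1)))    ≡⟨ cong vertex a+1+[m∸1]≡a+m ⟩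
    vertex (toℕ a + m)                ≡⟨ vertex-+m (toℕ a) ⟩
    vertex (toℕ a)                    ≡⟨ vertex-toℕ a ⟩
    a                                 ∎
    where open ≡-Reasoning

  prev-next : ∀ a → prev (next a) ≡ a
  prev-next a = begin
    vertex (toℕ (vertex (suc (toℕ a))) + (m ∸ 1)) ≡⟨ cong (λ r → vertex (r + (m ∸ 1))) (toℕ-vertex (suc (toℕ a))) ⟩
    vertex (suc (toℕ a) % m + (m ∸ 1))            ≡⟨ vertex-cong (%-absorbˡ (suc (toℕ a)) (m ∸ 1)) ⟩
    vertex (suc (toℕ a) + (m ∸ 1))                ≡⟨ cong vertex a+1+[m∸1]≡a+m ⟩
    vertex (toℕ a + m)                            ≡⟨ vertex-+m (toℕ a) ⟩
    vertex (toℕ a)                                ≡⟨ vertex-toℕ a ⟩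
    a                                             ∎
    where open ≡-Reasoning

  CycSucc⇒≡next : ∀ {a b} → CycSucc m a b → b ≡ next a
  CycSucc⇒≡next {a} {b} (inj₁ 1+a≡b) = Fin.toℕ-injective (begin
    toℕ b                ≡⟨ m<n⇒m%n≡m (Fin.toℕ<n b) ⟨
    toℕ b % m            ≡⟨ cong (_% m) 1+a≡b ⟨
    suc (toℕ a) % m      ≡⟨ toℕ-vertex (suc (toℕ a)) ⟨
    toℕ (next a)         ∎)
    where open ≡-Reasoning
  CycSucc⇒≡next {a} {b} (inj₂ (1+a≡m , b≡0)) = Fin.toℕ-injective (begin
    toℕ b                ≡⟨ trans b≡0 (sym (n%n≡0 m)) ⟩
    m % m                ≡⟨ cong (_% m) 1+a≡m ⟨
    suc (toℕ a) % m      ≡⟨ toℕ-vertex (suc (toℕ a)) ⟨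
    toℕ (next a)         ∎)
    where open ≡-Reasoning

  CycSucc-next : ∀ a → CycSucc m a (next a)
  CycSucc-next a with suc (toℕ a) <? m
  ... | yes 1+a<m = inj₁ (sym (trans (toℕ-vertex (suc (toℕ a))) (m<n⇒m%n≡m 1+a<m)))
  ... | no 1+a≮m = inj₂ (1+a≡m , trans (toℕ-vertex (suc (toℕ a))) (trans (cong (_% m) 1+a≡m) (n%n≡0 m)))
    where
    1+a≡m : suc (toℕ a) ≡ m
    1+a≡m = ≤-antisym (Fin.toℕ<n a) (≮⇒≥ 1+a≮m)

  next-next≢ : ∀ a → next (next a) ≢ a
  next-next≢ a eq = %-shift-≢ (toℕ a) {2} (s≤s z≤n) 3≤m (vertex-injective (begin
    vertex (toℕ a + 2)          ≡⟨ cong vertex (+-comm (toℕ a) 2) ⟩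
    vertex (suc (suc (toℕ a)))  ≡⟨ next-vertex (suc (toℕ a)) ⟨
    next (next a)               ≡⟨ eq ⟩
    a                           ≡⟨ vertex-toℕ a ⟨
    vertex (toℕ a)              ∎))
    where open ≡-Reasoning

  EdgeAt : Fin m → Fin m → Fin m → Set
  EdgeAt x u w = (u ≡ x × w ≡ next x) ⊎ (w ≡ x × u ≡ next x)

  EdgeAt-swap : ∀ {x u w} → EdgeAt x u w → EdgeAt x w u
  EdgeAt-swap (inj₁ e) = inj₂ e
  EdgeAt-swap (inj₂ e) = inj₁ e

  EdgeAt-unique : ∀ {x y u w} → EdgeAt x u w → EdgeAt y u w → x ≡ y
  EdgeAt-unique (inj₁ (refl , _)) (inj₁ (refl , _)) = refl
  EdgeAt-unique (inj₂ (refl , _)) (inj₂ (refl , _)) = refl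
  EdgeAt-unique (inj₁ (refl , refl)) (inj₂ (w≡y , u≡y+1)) =
    contradiction (trans (cong next (sym u≡y+1)) w≡y) (next-next≢ _)
  EdgeAt-unique (inj₂ (refl , refl)) (inj₁ (u≡y , w≡y+1)) =
    contradiction (trans (cong next (sym w≡y+1)) u≡y) (next-next≢ _)

  position : ∀ {u w} → Adj G u w → Fin m
  position {u} (inj₁ _) = u
  position {w = w} (inj₂ _) = w

  EdgeAt-position : ∀ {u w} (e : Adj G u w) → EdgeAt (position e) u w
  EdgeAt-position (inj₁ u→w) = inj₁ (refl , CycSucc⇒≡next u→w)
  EdgeAt-position (inj₂ w→u) = inj₂ (refl , CycSucc⇒≡next w→u)

  usage : ∀ {a b} → Walk G a b → Fin m → ℕ
  usage (stop _)     x = 0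
  usage (step _ e w) x = δ (position e) x + usage w x

  ∑-usage : ∀ {a b} (w : Walk G a b) → ∑[ x < m ] usage w x ≡ len G w
  ∑-usage (stop _)     = ∑-zero {m} λ _ → refl
  ∑-usage (step _ e w) =
    trans (∑-distrib-+ (δ (position e)) (usage w)) (cong₂ _+_ (∑-δ (position e)) (∑-usage w))

  usage-edge : ∀ {a b} (w : Walk G a b) x → 0 < usage w x →
               ∃₂ λ u u′ → (u , u′) ∈ edges G w × EdgeAt x u u′
  usage-edge (step u {u′} e w) x pos with position e Fin.≟ x
  ... | yes refl = u , u′ , here refl , EdgeAt-position e
  ... | no _ with usage-edge w x pos
  ...   | v , v′ , v∈w , at = v , v′ , there v∈w , at

  edge-endpoints : ∀ {a b u u′} (w : Walk G a b) → (u , u′) ∈ edges G w →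
                   u ∈ vertices G w × u′ ∈ vertices G w
  edge-endpoints (step _ _ (stop _))     (here refl) = here refl , there (here refl)
  edge-endpoints (step _ _ (step _ _ _)) (here refl) = here refl , there (here refl)
  edge-endpoints (step _ _ w)            (there e∈w) with edge-endpoints w e∈w
  ... | u∈w , u′∈w = there u∈w , there u′∈w

  EdgeAt-∈ : ∀ {x u u′ v v′} {L : List (Fin m)} → EdgeAt x u u′ → EdgeAt x v v′ → v ∈ L → v′ ∈ L → u ∈ L
  EdgeAt-∈ (inj₁ (refl , _)) (inj₁ (refl , _)) v∈L _    = v∈L
  EdgeAt-∈ (inj₁ (refl , _)) (inj₂ (refl , _)) _   v′∈L = v′∈L
  EdgeAt-∈ (inj₂ (_ , refl)) (inj₁ (_ , refl)) _   v′∈L = v′∈L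
  EdgeAt-∈ (inj₂ (_ , refl)) (inj₂ (_ , refl)) v∈L _    = v∈L

  usage≤1 : ∀ {a b} (w : Walk G a b) → Unique (vertices G w) → ∀ x → usage w x ≤ 1
  usage≤1 (stop _) _ x = z≤n
  usage≤1 (step u e w) (u∉w ∷ unique) x with position e Fin.≟ x
  ... | no _ = usage≤1 w unique x
  ... | yes refl with usage w (position e) in eq
  ...   | zero  = ≤-refl
  ...   | suc _ with usage-edge w (position e) (subst (0 <_) (sym eq) (s≤s z≤n))
  ...     | v , v′ , v∈w , at = contradiction refl (All.lookup u∉w u∈w)
    where
    u∈w : u ∈ vertices G w
    u∈w = EdgeAt-∈ (EdgeAt-position e) at (proj₁ (edge-endpoints w v∈w)) (proj₂ (edge-endpoints w v∈w))

  degree : ∀ {a b} → Walk G a b → Fin m → ℕ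
  degree w t = usage w (prev t) + usage w t

  δ-prev : ∀ x t → δ x (prev t) ≡ δ (next x) t
  δ-prev x t with x Fin.≟ prev t | next x Fin.≟ t
  ... | yes _      | yes _      = refl
  ... | no _       | no _       = refl
  ... | yes refl   | no x+1≢t   = contradiction (next-prev t) x+1≢t
  ... | no x≢t-1   | yes refl   = contradiction (sym (prev-next x)) x≢t-1

  δ-EdgeAt : ∀ {x u u′} → EdgeAt x u u′ → ∀ t → δ x (prev t) + δ x t ≡ δ u t + δ u′ t
  δ-EdgeAt {x} (inj₁ (refl , refl)) t = trans (cong (_+ δ x t) (δ-prev x t)) (+-comm (δ (next x) t) (δ x t))
  δ-EdgeAt {x} (inj₂ (refl , refl)) t = cong (_+ δ x t) (δ-prev x t)

  degree-parity : ∀ {a b} (w : Walk G a b) t → ∃[ q ] degree w t + (δ a t + δ b t) ≡ q + q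
  degree-parity (stop a) t = δ a t , refl
  degree-parity {b = b} (step a {a′} e w) t with degree-parity w t
  ... | q , even = δ a t + q , (begin
    degree (step a e w) t + (δ a t + δ b t)
      ≡⟨ cong (_+ (δ a t + δ b t)) (shuffle (δ x (prev t)) (usage w (prev t)) (δ x t) (usage w t)) ⟩
    (δ x (prev t) + δ x t) + degree w t + (δ a t + δ b t)
      ≡⟨ cong (λ k → k + degree w t + (δ a t + δ b t)) (δ-EdgeAt (EdgeAt-position e) t) ⟩
    (δ a t + δ a′ t) + degree w t + (δ a t + δ b t)
      ≡⟨ regroup (δ a t) (δ a′ t) (degree w t) (δ b t) ⟩
    δ a t + δ a t + (degree w t + (δ a′ t + δ b t))
      ≡⟨ cong (δ a t + δ a t +_) even ⟩
    δ a t + δ a t + (q + q)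
      ≡⟨ shuffle (δ a t) (δ a t) q q ⟩
    (δ a t + q) + (δ a t + q) ∎)
    where
    open ≡-Reasoning
    x = position e
    shuffle : ∀ p q r s → (p + q) + (r + s) ≡ (p + r) + (q + s)
    shuffle = solve-∀
    regroup : ∀ p q r s → (p + q) + r + (p + s) ≡ p + p + (r + (q + s))
    regroup = solve-∀

  ∑-degree : ∀ {a b} (w : Walk G a b) → ∑[ t < m ] degree w t ≡ len G w + len G w
  ∑-degree w = trans (∑-distrib-+ (usage w ∘ prev) (usage w)) (cong₂ _+_ (∑-usage-prev w) (∑-usage w))
    where
    ∑-usage-prev : ∀ {a b} (w : Walk G a b) → ∑[ t < m ] usage w (prev t) ≡ len G w
    ∑-usage-prev (stop _)     = ∑-zero {m} λ _ → refl
    ∑-usage-prev (step _ e w) = begin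
      ∑[ t < m ] (δ (position e) (prev t) + usage w (prev t))
        ≡⟨ ∑-distrib-+ (δ (position e) ∘ prev) (usage w ∘ prev) ⟩
      ∑[ t < m ] δ (position e) (prev t) + ∑[ t < m ] usage w (prev t)
        ≡⟨ cong₂ _+_ (trans (sum-cong-≗ (δ-prev (position e))) (∑-δ (next (position e)))) (∑-usage-prev w) ⟩
      suc (len G w) ∎
      where open ≡-Reasoning

  cdist : ℕ → ℕ → ℕ
  cdist x y = ∣ x - y ∣ ⊓ (m ∸ ∣ x - y ∣)

  private
    ∣n-1+n∣≡1 : ∀ x → ∣ x - suc x ∣ ≡ 1
    ∣n-1+n∣≡1 zero    = refl
    ∣n-1+n∣≡1 (suc x) = ∣n-1+n∣≡1 x

    ∸-lipschitz : ∀ k {p q} → q ≤ suc p → k ∸ p ≤ suc (k ∸ q)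
    ∸-lipschitz zero {p} {q} _ = subst (_≤ suc (0 ∸ q)) (sym (0∸n≡0 p)) z≤n
    ∸-lipschitz (suc k) {p} {zero} _ = m≤n⇒m≤1+n (m∸n≤m (suc k) p)
    ∸-lipschitz (suc k) {zero} {suc zero} _ = ≤-refl
    ∸-lipschitz (suc k) {zero} {suc (suc q)} (s≤s ())
    ∸-lipschitz (suc k) {suc p} {suc q} (s≤s q≤1+p) = ∸-lipschitz k q≤1+p

    cdist-lipschitz : ∀ x y z → ∣ x - z ∣ ≤ suc ∣ y - z ∣ → ∣ y - z ∣ ≤ suc ∣ x - z ∣ →
                      cdist x z ≤ suc (cdist y z)
    cdist-lipschitz _ _ _ x≤1+y y≤1+x = ⊓-mono-≤ x≤1+y (∸-lipschitz m y≤1+x)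

    ∣-∣-suc : ∀ x z → ∣ suc x - z ∣ ≤ suc ∣ x - z ∣
    ∣-∣-suc x z = subst (λ k → ∣ suc x - z ∣ ≤ k + ∣ x - z ∣)
                        (trans (∣-∣-comm (suc x) x) (∣n-1+n∣≡1 x)) (∣-∣-triangle (suc x) x z)

    ∣-∣-pred : ∀ x z → ∣ x - z ∣ ≤ suc ∣ suc x - z ∣
    ∣-∣-pred x z = subst (λ k → ∣ x - z ∣ ≤ k + ∣ suc x - z ∣) (∣n-1+n∣≡1 x) (∣-∣-triangle x (suc x) z)

  cdist-suc-≤ : ∀ x z → cdist (suc x) z ≤ suc (cdist x z)
  cdist-suc-≤ x z = cdist-lipschitz (suc x) x z (∣-∣-suc x z) (∣-∣-pred x z)

  cdist-≤-suc : ∀ x z → cdist x z ≤ suc (cdist (suc x) z)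
  cdist-≤-suc x z = cdist-lipschitz x (suc x) z (∣-∣-pred x z) (∣-∣-suc x z)

  -- cdist x z depends on x only modulo m; this instance handles the edge {m - 1 , 0}.
  cdist-m : ∀ z → z ≤ m → cdist m z ≡ cdist 0 z
  cdist-m z z≤m = begin
    ∣ m - z ∣ ⊓ (m ∸ ∣ m - z ∣)  ≡⟨ cong (λ k → k ⊓ (m ∸ k)) (m≤n⇒∣n-m∣≡n∸m z≤m) ⟩
    (m ∸ z) ⊓ (m ∸ (m ∸ z))      ≡⟨ cong ((m ∸ z) ⊓_) (m∸[m∸n]≡n z≤m) ⟩
    (m ∸ z) ⊓ z                  ≡⟨ ⊓-comm (m ∸ z) z ⟩
    z ⊓ (m ∸ z)                  ∎
    where open ≡-Reasoning

  cdist-Adj : ∀ {u w} (z : Fin m) → Adj G u w → cdist (toℕ u) (toℕ z) ≤ suc (cdist (toℕ w) (toℕ z))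
  cdist-Adj {u} z (inj₁ (inj₁ 1+u≡w)) =
    subst (λ k → cdist (toℕ u) (toℕ z) ≤ suc (cdist k (toℕ z))) 1+u≡w (cdist-≤-suc (toℕ u) (toℕ z))
  cdist-Adj {u} z (inj₁ (inj₂ (1+u≡m , w≡0))) = subst (λ k → cdist (toℕ u) (toℕ z) ≤ suc k)
    (trans (cong (λ k → cdist k (toℕ z)) 1+u≡m) (trans (cdist-m (toℕ z) (<⇒≤ (Fin.toℕ<n z)))
           (cong (λ k → cdist k (toℕ z)) (sym w≡0))))
    (cdist-≤-suc (toℕ u) (toℕ z))
  cdist-Adj {w = w} z (inj₂ (inj₁ 1+w≡u)) =
    subst (λ k → cdist k (toℕ z) ≤ suc (cdist (toℕ w) (toℕ z))) 1+w≡u (cdist-suc-≤ (toℕ w) (toℕ z))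
  cdist-Adj {w = w} z (inj₂ (inj₂ (1+w≡m , u≡0))) = subst (λ k → k ≤ suc (cdist (toℕ w) (toℕ z)))
    (trans (cong (λ k → cdist k (toℕ z)) 1+w≡m) (trans (cdist-m (toℕ z) (<⇒≤ (Fin.toℕ<n z)))
           (cong (λ k → cdist k (toℕ z)) (sym u≡0))))
    (cdist-suc-≤ (toℕ w) (toℕ z))

  cdist≤len : ∀ {a b} (w : Walk G a b) → cdist (toℕ a) (toℕ b) ≤ len G w
  cdist≤len (stop a) = ≤-reflexive (cong (λ k → k ⊓ (m ∸ k)) (∣n-n∣≡0 (toℕ a)))
  cdist≤len {b = b} (step a e w) = ≤-trans (cdist-Adj b e) (s≤s (cdist≤len w))

  open PairSums G public

  private
    lt : Fin m → Fin m → ℕ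
    lt a b = indicator (a Fin.<? b)

    restrict-const : ∀ a b c → restrict (a Fin.<? b) (λ _ → c) ≡ lt a b * c
    restrict-const a b c with a Fin.<? b
    ... | yes _ = sym (+-identityʳ c)
    ... | no _  = refl

    trichotomy : ∀ a b → lt a b + lt b a + δ a b ≡ 1
    trichotomy a b with a Fin.<? b | b Fin.<? a | a Fin.≟ b
    ... | yes a<b | _       | yes refl = contradiction a<b (<-irrefl refl)
    ... | yes a<b | yes b<a | no _     = contradiction b<a (<⇒≯ a<b)
    ... | yes _   | no _    | no _     = refl
    ... | no _    | yes b<a | yes refl = contradiction b<a (<-irrefl refl)
    ... | no _    | yes _   | no _     = refl
    ... | no _    | no _    | yes _    = refl
    ... | no a≮b  | no b≮a  | no a≢b   =
      contradiction (Fin.toℕ-injective (≤-antisym (≮⇒≥ b≮a) (≮⇒≥ a≮b))) a≢b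

    pairs-containing : ∀ a → sum (lt a) + sum (λ b → lt b a) + 1 ≡ m
    pairs-containing a = begin
      sum (lt a) + sum (λ b → lt b a) + 1              ≡⟨ cong₂ _+_ (∑-distrib-+ (lt a) (λ b → lt b a)) (∑-δ a) ⟨
      ∑[ b < m ] (lt a b + lt b a) + ∑[ b < m ] δ a b  ≡⟨ ∑-distrib-+ (λ b → lt a b + lt b a) (δ a) ⟨
      ∑[ b < m ] (lt a b + lt b a + δ a b)             ≡⟨ sum-cong-≗ (trichotomy a) ⟩
      ∑[ b < m ] 1                                     ≡⟨ trans (∑-const m 1) (*-identityʳ m) ⟩
      m                                                ∎
      where open ≡-Reasoning

  ∑ᴾ-as-double : ∀ (g : Fin m → Fin m → ℕ) →
    ∑ᴾ (λ p → g (proj₁ (proj₁ p)) (proj₂ (proj₁ p))) ≡ ∑[ a < m ] ∑[ b < m ] (lt a b * g a b)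
  ∑ᴾ-as-double g = sum-cong-≗ λ a → sum-cong-≗ λ b → restrict-const a b (g a b)

  ∑ᴾ-endpoints : ∀ (f : Fin m → ℕ) →
    ∑ᴾ (λ p → f (proj₁ (proj₁ p)) + f (proj₂ (proj₁ p))) + sum f ≡ m * sum f
  ∑ᴾ-endpoints f = begin
    ∑ᴾ (λ p → f (proj₁ (proj₁ p)) + f (proj₂ (proj₁ p))) + sum f
      ≡⟨ cong (_+ sum f) (∑ᴾ-as-double (λ a b → f a + f b)) ⟩
    ∑[ a < m ] ∑[ b < m ] (lt a b * (f a + f b)) + sum f
      ≡⟨ cong (_+ sum f) (trans (sum-cong-≗ λ a → trans (sum-cong-≗ λ b → *-distribˡ-+ (lt a b) (f a) (f b))
                                                        (∑-distrib-+ (λ b → lt a b * f a) (λ b → lt a b * f b)))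
                                (∑-distrib-+ (λ a → ∑[ b < m ] (lt a b * f a)) (λ a → ∑[ b < m ] (lt a b * f b)))) ⟩
    ∑[ a < m ] ∑[ b < m ] (lt a b * f a) + ∑[ a < m ] ∑[ b < m ] (lt a b * f b) + sum f
      ≡⟨ cong (λ k → ∑[ a < m ] ∑[ b < m ] (lt a b * f a) + k + sum f) (∑-comm (λ a b → lt a b * f b)) ⟩
    ∑[ a < m ] ∑[ b < m ] (lt a b * f a) + ∑[ a < m ] ∑[ b < m ] (lt b a * f a) + sum f
      ≡⟨ trans (∑-distrib-+ (λ a → rowˡ a + rowʳ a) f) (cong (_+ sum f) (∑-distrib-+ rowˡ rowʳ)) ⟨
    ∑[ a < m ] (∑[ b < m ] (lt a b * f a) + ∑[ b < m ] (lt b a * f a) + f a)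
      ≡⟨ sum-cong-≗ row ⟩
    ∑[ a < m ] (m * f a)
      ≡⟨ *-distribˡ-sum m f ⟨
    m * sum f ∎
    where
    open ≡-Reasoning
    rowˡ rowʳ : Fin m → ℕ
    rowˡ a = ∑[ b < m ] (lt a b * f a)
    rowʳ a = ∑[ b < m ] (lt b a * f a)
    row : ∀ a → ∑[ b < m ] (lt a b * f a) + ∑[ b < m ] (lt b a * f a) + f a ≡ m * f a
    row a = begin
      ∑[ b < m ] (lt a b * f a) + ∑[ b < m ] (lt b a * f a) + f a
        ≡⟨ cong₂ (λ x y → x + y + f a) (*-distribʳ-sum (f a) (lt a)) (*-distribʳ-sum (f a) (λ b → lt b a)) ⟨
      sum (lt a) * f a + sum (λ b → lt b a) * f a + f a
        ≡⟨ cong (sum (lt a) * f a + sum (λ b → lt b a) * f a +_) (*-identityˡ (f a)) ⟨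
      sum (lt a) * f a + sum (λ b → lt b a) * f a + 1 * f a
        ≡⟨ trans (*-distribʳ-+ (f a) (sum (lt a) + sum (λ b → lt b a)) 1)
                 (cong (_+ 1 * f a) (*-distribʳ-+ (f a) (sum (lt a)) (sum (λ b → lt b a)))) ⟨
      (sum (lt a) + sum (λ b → lt b a) + 1) * f a
        ≡⟨ cong (_* f a) (pairs-containing a) ⟩
      m * f a ∎

  EdgeAt-orientation : ∀ {x u u′ v v′} → EdgeAt x u u′ → EdgeAt x v v′ →
                       (v ≡ u × v′ ≡ u′) ⊎ (v ≡ u′ × v′ ≡ u)
  EdgeAt-orientation (inj₁ (refl , refl)) (inj₁ (refl , refl)) = inj₁ (refl , refl)
  EdgeAt-orientation (inj₁ (refl , refl)) (inj₂ (refl , refl)) = inj₂ (refl , refl)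
  EdgeAt-orientation (inj₂ (refl , refl)) (inj₁ (refl , refl)) = inj₂ (refl , refl)
  EdgeAt-orientation (inj₂ (refl , refl)) (inj₂ (refl , refl)) = inj₁ (refl , refl)

  usage⇒ShareEdge : ∀ {a b c d} (P : Path G a b) (Q : Path G c d) x →
                    0 < usage (proj₁ P) x → 0 < usage (proj₁ Q) x → ShareEdge G P Q
  usage⇒ShareEdge P Q x inP inQ
    with usage-edge (proj₁ P) x inP | usage-edge (proj₁ Q) x inQ
  ... | u , u′ , uu′∈P , atP | v , v′ , vv′∈Q , atQ with EdgeAt-orientation atP atQ
  ...   | inj₁ (refl , refl) = u , u′ , uu′∈P , inj₁ vv′∈Q
  ...   | inj₂ (refl , refl) = u , u′ , uu′∈P , inj₂ vv′∈Q

  module PackingBound {𝒫 : PathSystem G} {k : ℕ} (packing : GlobalPacking G 𝒫 k) where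

    private
      ω : Pair G → Fin k
      ω = proj₁ packing

      walk : (p : Pair G) → Walk G (proj₁ (proj₁ p)) (proj₂ (proj₁ p))
      walk p = proj₁ (𝒫 p)

    colour-class-usage≤1 : ∀ c x → ∑ᴾ (λ p → δ (ω p) c * usage (walk p) x) ≤ 1
    colour-class-usage≤1 c x with ∑ᴾ (λ p → δ (ω p) c * usage (walk p) x) in eq
    ... | zero = z≤n
    ... | suc _ with ∑ᴾ-pos _ (subst (0 <_) (sym eq) (s≤s z≤n))
    ...   | p , pos = begin
      suc _                                       ≡⟨ eq ⟨
      ∑ᴾ (λ q → δ (ω q) c * usage (walk q) x)    ≡⟨ ∑ᴾ-single p others ⟩
      δ (ω p) c * usage (walk p) x                ≤⟨ *-mono-≤ (δ≤1 (ω p) c) (usage≤1 (walk p) (proj₂ (𝒫 p)) x) ⟩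
      1                                           ∎
      where
      open ≤-Reasoning
      others : ∀ q → proj₁ q ≢ proj₁ p → δ (ω q) c * usage (walk q) x ≡ 0
      others q q≢p with δ (ω q) c * usage (walk q) x in eq′
      ... | zero = refl
      ... | suc _ with δ*-pos {i = ω q} {c} (subst (0 <_) (sym eq′) (s≤s z≤n)) | δ*-pos {i = ω p} {c} pos
      ...   | ωq≡c , inQ | ωp≡c , inP =
        ⊥-elim (proj₂ packing q p q≢p (usage⇒ShareEdge (𝒫 q) (𝒫 p) x inQ inP) (trans ωq≡c (sym ωp≡c)))

    ∑ᴾ-usage≤k : ∀ x → ∑ᴾ (λ p → usage (walk p) x) ≤ k
    ∑ᴾ-usage≤k x = begin
      ∑ᴾ (λ p → usage (walk p) x)                              ≡⟨ ∑ᴾ-cong (λ p → ∑-δ-select (ω p) (λ _ → usage (walk p) x)) ⟨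
      ∑ᴾ (λ p → ∑[ c < k ] (δ (ω p) c * usage (walk p) x))    ≡⟨ ∑ᴾ-comm (λ p c → δ (ω p) c * usage (walk p) x) ⟩
      ∑[ c < k ] ∑ᴾ (λ p → δ (ω p) c * usage (walk p) x)      ≤⟨ ∑-mono-≤ (λ c → colour-class-usage≤1 c x) ⟩
      ∑[ c < k ] 1                                             ≡⟨ trans (∑-const k 1) (*-identityʳ k) ⟩
      k                                                        ∎
      where open ≤-Reasoning

    ∑ᴾ-degree≤2k : ∀ t → ∑ᴾ (λ p → degree (walk p) t) ≤ k + k
    ∑ᴾ-degree≤2k t = subst (_≤ k + k) (sym (∑ᴾ-distrib-+ _ _))
                           (+-mono-≤ (∑ᴾ-usage≤k (prev t)) (∑ᴾ-usage≤k t))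

    -- t ends m - 1 paths, an odd number, and a path's degree at t has the parity of its ends at t.
    ∑ᴾ-degree≢2k : ∀ {n} → m ≡ n + n → ∀ t → ∑ᴾ (λ p → degree (walk p) t) ≢ k + k
    ∑ᴾ-degree≢2k {n} m≡2n t D≡2k = double+odd≢double k {E} {n} (∑ᴾ half) (trans endpoint-count m≡2n) (begin
      k + k + E                                   ≡⟨ cong (_+ E) D≡2k ⟨
      ∑ᴾ (λ p → degree (walk p) t) + E            ≡⟨ ∑ᴾ-distrib-+ _ _ ⟨
      ∑ᴾ (λ p → degree (walk p) t + ends p)       ≡⟨ ∑ᴾ-cong (λ p → proj₂ (degree-parity (walk p) t)) ⟩
      ∑ᴾ (λ p → half p + half p)                  ≡⟨ ∑ᴾ-distrib-+ half half ⟩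
      ∑ᴾ half + ∑ᴾ half                           ∎)
      where
      open ≡-Reasoning
      ends : Pair G → ℕ
      ends p = δ (proj₁ (proj₁ p)) t + δ (proj₂ (proj₁ p)) t
      E = ∑ᴾ ends
      half : Pair G → ℕ
      half p = proj₁ (degree-parity (walk p) t)
      endpoint-count : E + 1 ≡ m
      endpoint-count = trans (cong (E +_) (sym ∑δ)) (trans (∑ᴾ-endpoints (λ x → δ x t)) (trans (cong (m *_) ∑δ) (*-identityʳ m)))
        where
        ∑δ : ∑[ x < m ] δ x t ≡ 1
        ∑δ = trans (sum-cong-≗ λ x → δ-sym x t) (∑-δ t)

    ∑ᴾ-length-bound : ∀ {n} → m ≡ n + n →
      ∑ᴾ (λ p → len G (walk p)) + ∑ᴾ (λ p → len G (walk p)) + m ≤ m * (k + k)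
    ∑ᴾ-length-bound {n} m≡2n = begin
      S + S + m                                       ≡⟨ cong₂ _+_ ∑degree (trans (∑-const m 1) (*-identityʳ m)) ⟨
      ∑[ t < m ] D t + ∑[ t < m ] 1                   ≡⟨ ∑-distrib-+ D (λ _ → 1) ⟨
      ∑[ t < m ] (D t + 1)                            ≤⟨ ∑-mono-≤ (λ t → subst (_≤ k + k) (+-comm 1 (D t))
                                                           (≤∧≢⇒< (∑ᴾ-degree≤2k t) (∑ᴾ-degree≢2k {n} m≡2n t))) ⟩
      ∑[ t < m ] (k + k)                              ≡⟨ ∑-const m (k + k) ⟩
      m * (k + k)                                     ∎
      where
      open ≤-Reasoning
      S = ∑ᴾ (λ p → len G (walk p))
      D : Fin m → ℕ
      D t = ∑ᴾ (λ p → degree (walk p) t)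
      ∑degree : ∑[ t < m ] D t ≡ S + S
      ∑degree = begin-equality
        ∑[ t < m ] D t                                   ≡⟨ ∑ᴾ-comm (λ p t → degree (walk p) t) ⟨
        ∑ᴾ (λ p → ∑[ t < m ] degree (walk p) t)          ≡⟨ ∑ᴾ-cong (λ p → ∑-degree (walk p)) ⟩
        ∑ᴾ (λ p → len G (walk p) + len G (walk p))       ≡⟨ ∑ᴾ-distrib-+ _ _ ⟩
        S + S                                            ∎

  ∑ᴾ-cdist : ∀ {n} → m ≡ n + n → ∑ᴾ (λ p → cdist (toℕ (proj₁ (proj₁ p))) (toℕ (proj₂ (proj₁ p)))) ≡ n * n * n
  ∑ᴾ-cdist {n} m≡2n = begin
    ∑ᴾ (λ p → cdist (toℕ (proj₁ (proj₁ p))) (toℕ (proj₂ (proj₁ p))))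
      ≡⟨ ∑ᴾ-as-double (λ a b → cdist (toℕ a) (toℕ b)) ⟩
    ∑[ a < m ] ∑[ b < m ] (lt a b * cdist (toℕ a) (toℕ b))
      ≡⟨ ∑-comm (λ a b → lt a b * cdist (toℕ a) (toℕ b)) ⟩
    ∑[ b < m ] ∑[ a < m ] (lt a b * cdist (toℕ a) (toℕ b))
      ≡⟨ trans (sum-cong-≗ {m} λ b → ∑-toℕ m (λ A → below A (toℕ b))) (∑-toℕ m (λ B → ∑ℕ m (λ A → below A B))) ⟩
    ∑ℕ m (λ B → ∑ℕ m (λ A → below A B))
      ≡⟨ ∑ℕ-cong m (λ B B<m → trans (∑ℕ-restrict (λ A → cdist A B) (<⇒≤ B<m)) (sym (∑ℕ-reverse B (λ A → cdist A B)))) ⟩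
    ∑ℕ m (λ B → ∑ℕ B (λ j → cdist (B ∸ suc j) B))
      ≡⟨ ∑ℕ-cong m (λ B _ → ∑ℕ-cong B (λ j j<B → cdist-gap j<B)) ⟩
    ∑ℕ m (λ B → ∑ℕ B (λ j → gap (suc j)))
      ≡⟨ ∑ℕ-triangle m (gap ∘ suc) ⟩
    ∑ℕ m (λ j → (m ∸ suc j) * gap (suc j))
      ≡⟨ cong (λ k → ∑ℕ k (λ j → (k ∸ suc j) * (suc j ⊓ (k ∸ suc j)))) m≡2n ⟩
    ∑ℕ (n + n) (gap-term n)
      ≡⟨ ∑ℕ-cyclic-gaps n ⟩
    n * n * n ∎
    where
    open ≡-Reasoning
    below : ℕ → ℕ → ℕ
    below A B = indicator (A <? B) * cdist A B
    gap : ℕ → ℕ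
    gap d = d ⊓ (m ∸ d)
    cdist-gap : ∀ {B j} → j < B → cdist (B ∸ suc j) B ≡ gap (suc j)
    cdist-gap {B} {j} j<B = cong (λ d → d ⊓ (m ∸ d))
      (trans (m≤n⇒∣m-n∣≡n∸m (m∸n≤m B (suc j))) (m∸[m∸n]≡n j<B))

  vertex-step : ∀ x → CycSucc m (vertex x) (vertex (suc x))
  vertex-step x = subst (CycSucc m (vertex x)) (next-vertex x) (CycSucc-next (vertex x))

  Along : ℕ → ℕ → ∀ {a b} → Walk G a b → Set
  Along s ℓ w = ∀ {u u′} → (u , u′) ∈ edges G w → ∃[ j ] j < ℓ × EdgeAt (vertex (s + j)) u u′

  retarget : ∀ {s ℓ a b a′ b′} → a ≡ a′ → b ≡ b′ → (w : Walk G a b) → Unique (vertices G w) →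
             Along s ℓ w → Σ (Path G a′ b′) (λ P → Along s ℓ (proj₁ P))
  retarget refl refl w unique along = (w , unique) , along

  -- reach s ℓ ≡ s + ℓ, by recursion on ℓ so that the type of ascend needs no transport.
  reach : ℕ → ℕ → ℕ
  reach s zero    = s
  reach s (suc ℓ) = reach (suc s) ℓ

  reach≡+ : ∀ s ℓ → reach s ℓ ≡ s + ℓ
  reach≡+ s zero    = sym (+-identityʳ s)
  reach≡+ s (suc ℓ) = trans (reach≡+ (suc s) ℓ) (sym (+-suc s ℓ))

  ascend : ∀ s ℓ → Walk G (vertex s) (vertex (reach s ℓ))
  ascend s zero    = stop (vertex s)
  ascend s (suc ℓ) = step (vertex s) (inj₁ (vertex-step s)) (ascend (suc s) ℓ)

  descend : ∀ s ℓ → Walk G (vertex (ℓ + s)) (vertex s)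
  descend s zero    = stop (vertex s)
  descend s (suc ℓ) = step (vertex (suc ℓ + s)) (inj₂ (vertex-step (ℓ + s))) (descend s ℓ)

  ascend-vertices : ∀ s ℓ {u} → u ∈ vertices G (ascend s ℓ) → ∃[ j ] j ≤ ℓ × u ≡ vertex (s + j)
  ascend-vertices s zero    (here refl) = 0 , z≤n , cong vertex (sym (+-identityʳ s))
  ascend-vertices s (suc ℓ) (here refl) = 0 , z≤n , cong vertex (sym (+-identityʳ s))
  ascend-vertices s (suc ℓ) (there u∈) with ascend-vertices (suc s) ℓ u∈
  ... | j , j≤ℓ , refl = suc j , s≤s j≤ℓ , cong vertex (sym (+-suc s j))

  descend-vertices : ∀ s ℓ {u} → u ∈ vertices G (descend s ℓ) → ∃[ j ] j ≤ ℓ × u ≡ vertex (j + s)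
  descend-vertices s zero    (here refl) = 0 , z≤n , refl
  descend-vertices s (suc ℓ) (here refl) = suc ℓ , ≤-refl , refl
  descend-vertices s (suc ℓ) (there u∈) with descend-vertices s ℓ u∈
  ... | j , j≤ℓ , u≡ = j , m≤n⇒m≤1+n j≤ℓ , u≡

  vertex-shift-≢ : ∀ x {d} → 0 < d → d < m → vertex x ≢ vertex (x + d)
  vertex-shift-≢ x {d} 0<d d<m eq = %-shift-≢ x 0<d d<m (sym (vertex-injective {x} {x + d} eq))

  ascend-unique : ∀ s ℓ → ℓ < m → Unique (vertices G (ascend s ℓ))
  ascend-unique s zero    _   = All.[] ∷ []
  ascend-unique s (suc ℓ) ℓ<m = All.tabulate fresh ∷ ascend-unique (suc s) ℓ (<-trans (n<1+n ℓ) ℓ<m)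
    where
    fresh : ∀ {u} → u ∈ vertices G (ascend (suc s) ℓ) → vertex s ≢ u
    fresh u∈ with ascend-vertices (suc s) ℓ u∈
    ... | j , j≤ℓ , refl = λ eq → vertex-shift-≢ s (s≤s z≤n) (≤-<-trans (s≤s j≤ℓ) ℓ<m)
                                    (trans eq (cong vertex (sym (+-suc s j))))

  descend-unique : ∀ s ℓ → ℓ < m → Unique (vertices G (descend s ℓ))
  descend-unique s zero    _   = All.[] ∷ []
  descend-unique s (suc ℓ) ℓ<m = All.tabulate fresh ∷ descend-unique s ℓ (<-trans (n<1+n ℓ) ℓ<m)
    where
    fresh : ∀ {u} → u ∈ vertices G (descend s ℓ) → vertex (suc ℓ + s) ≢ u
    fresh u∈ with descend-vertices s ℓ u∈
    ... | j , j≤ℓ , refl = λ eq → vertex-shift-≢ (j + s) (m<n⇒0<n∸m (s≤s j≤ℓ)) (≤-<-trans (m∸n≤m (suc ℓ) j) ℓ<m)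
                                    (sym (trans (cong vertex (gap j≤ℓ)) eq))
      where
      gap : ∀ {j} → j ≤ ℓ → j + s + (suc ℓ ∸ j) ≡ suc ℓ + s
      gap {j} j≤ℓ = trans (+-assoc j s _) (trans (cong (j +_) (+-comm s _))
                    (trans (sym (+-assoc j _ s)) (cong (_+ s) (m+[n∸m]≡n (m≤n⇒m≤1+n j≤ℓ)))))

  ascend-along : ∀ s ℓ → Along s ℓ (ascend s ℓ)
  ascend-along s (suc ℓ) (here refl) = 0 , s≤s z≤n , inj₁ (cong vertex (sym (+-identityʳ s)) ,
                                         trans (sym (next-vertex s)) (cong (next ∘ vertex) (sym (+-identityʳ s))))
  ascend-along s (suc ℓ) {u} {u′} (there e∈) with ascend-along (suc s) ℓ e∈
  ... | j , j<ℓ , at = suc j , s≤s j<ℓ , subst (λ x → EdgeAt (vertex x) u u′) (sym (+-suc s j)) at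

  descend-along : ∀ s ℓ → Along s ℓ (descend s ℓ)
  descend-along s (suc ℓ) (here refl) = ℓ , ≤-refl , inj₂ (cong vertex (+-comm ℓ s) ,
                                          trans (sym (next-vertex (ℓ + s))) (cong (next ∘ vertex) (+-comm ℓ s)))
  descend-along s (suc ℓ) (there e∈) with descend-along s ℓ e∈
  ... | j , j<ℓ , at = j , m<n⇒m<1+n j<ℓ , at

-- An explicit packing of C (2n) for odd n ≥ 3

Even : ℕ → Set
Even k = ∃[ q ] k ≡ 2 * q

data Parity (k : ℕ) : Set where
  even : ∀ q → k ≡ 2 * q → Parity k
  odd  : ∀ q → k ≡ suc (2 * q) → Parity k

parity : ∀ k → Parity k
parity zero = even 0 refl
parity (suc k) with parity k
... | even q k≡2q = odd q (cong suc k≡2q)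
... | odd q k≡2q+1 = even (suc q) (trans (cong suc k≡2q+1) (sym (*-suc 2 q)))

-- A layout sends each position to the segment (offset , length) covering it; positions covered
-- by no segment may be sent anywhere.

Segment : Set
Segment = ℕ × ℕ

Layout : Set
Layout = ℕ → Segment

cut : ℕ → Layout → Layout → Layout
cut b L R y with y <? b
... | yes _ = L y
... | no _  = R y

Covers : Layout → ℕ → ℕ → Set
Covers L o ℓ = ∀ j → j < ℓ → L (o + j) ≡ (o , ℓ)

covers-const : ∀ o ℓ → Covers (λ _ → (o , ℓ)) o ℓ
covers-const o ℓ _ _ = refl

covers-unit : ∀ o → Covers (λ y → (y , 1)) o 1
covers-unit o zero    _ = cong (_, 1) (+-identityʳ o)
covers-unit o (suc j) (s≤s ())

covers-cutˡ : ∀ {b L R o ℓ} → o + ℓ ≤ b → Covers L o ℓ → Covers (cut b L R) o ℓ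
covers-cutˡ {b} {o = o} o+ℓ≤b cov j j<ℓ with o + j <? b
... | yes _    = cov j j<ℓ
... | no o+j≮b = contradiction (<-≤-trans (+-monoʳ-< o j<ℓ) o+ℓ≤b) o+j≮b

covers-cutʳ : ∀ {b L R o ℓ} → b ≤ o → Covers R o ℓ → Covers (cut b L R) o ℓ
covers-cutʳ {b} {o = o} b≤o cov j j<ℓ with o + j <? b
... | yes o+j<b = contradiction (≤-trans b≤o (m≤m+n o j)) (<⇒≱ o+j<b)
... | no _      = cov j j<ℓ

module Construction (h′ : ℕ) where

  h n m : ℕ
  h = suc h′
  n = suc (2 * h)
  m = 2 * n

  3≤n : 3 ≤ n
  3≤n = s≤s (*-monoʳ-≤ 2 (s≤s z≤n))

  open Cycle m (≤-trans 3≤n (m≤m+n n (1 * n)))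

  m≡n+n : m ≡ n + n
  m≡n+n = cong (n +_) (+-identityʳ n)

  n<m : n < m
  n<m = subst (n <_) (sym m≡n+n) (m<m+n n {n} (s≤s z≤n))

  odd+n : ∀ {s q} → s ≡ suc (2 * q) → s + n ≡ 2 * suc (q + h)
  odd+n {q = q} refl = sum-of-odds q h
    where
    sum-of-odds : ∀ q h → suc (2 * q) + suc (2 * h) ≡ 2 * suc (q + h)
    sum-of-odds = solve-∀

  record ArcOf (a b : Fin m) : Set where
    field
      start length : ℕ
      start<m      : start < m
      length>0     : 0 < length
      length≤n     : length ≤ n
      half-even    : length ≡ n → Even start
      ends         : (vertex start ≡ a × vertex (start + length) ≡ b)
                   ⊎ (vertex start ≡ b × vertex (start + length) ≡ a)
      path         : Path G a b
      along        : Along start length (proj₁ path)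

  private
    same-vertex : ∀ {x y a a′} → x ≡ y → vertex x ≡ a → vertex y ≡ a′ → a ≡ a′
    same-vertex x≡y p q = trans (sym p) (trans (cong vertex x≡y) q)

  ArcOf-injective : ∀ {a b a′ b′} → toℕ a < toℕ b → toℕ a′ < toℕ b′ → (A : ArcOf a b) (A′ : ArcOf a′ b′) →
    ArcOf.start A ≡ ArcOf.start A′ → ArcOf.length A ≡ ArcOf.length A′ → (a , b) ≡ (a′ , b′)
  ArcOf-injective a<b a′<b′ A A′ s≡s′ ℓ≡ℓ′ with ArcOf.ends A | ArcOf.ends A′
  ... | inj₁ (sa , eb) | inj₁ (sa′ , eb′) = cong₂ _,_ (same-vertex s≡s′ sa sa′) (same-vertex (cong₂ _+_ s≡s′ ℓ≡ℓ′) eb eb′)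
  ... | inj₂ (sb , ea) | inj₂ (sb′ , ea′) = cong₂ _,_ (same-vertex (cong₂ _+_ s≡s′ ℓ≡ℓ′) ea ea′) (same-vertex s≡s′ sb sb′)
  ... | inj₁ (sa , eb) | inj₂ (sb′ , ea′) = contradiction
    (subst₂ (λ x y → toℕ x < toℕ y) (same-vertex s≡s′ sa sb′) (same-vertex (cong₂ _+_ s≡s′ ℓ≡ℓ′) eb ea′) a<b) (<⇒≯ a′<b′)
  ... | inj₂ (sb , ea) | inj₁ (sa′ , eb′) = contradiction
    (subst₂ (λ x y → toℕ x < toℕ y) (same-vertex (cong₂ _+_ s≡s′ ℓ≡ℓ′) ea eb′) (same-vertex s≡s′ sb sa′) a<b) (<⇒≯ a′<b′)

  forward-arc : ∀ a b → toℕ a < toℕ b → let d = toℕ b ∸ toℕ a in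
    d ≤ n → (d ≡ n → Even (toℕ a)) → ArcOf a b
  forward-arc a b a<b d≤n half-even = record
    { start = toℕ a ; length = d
    ; start<m = Fin.toℕ<n a ; length>0 = m<n⇒0<n∸m a<b ; length≤n = d≤n ; half-even = half-even
    ; ends = inj₁ (vertex-toℕ a , lands-on-b)
    ; path = proj₁ walk ; along = proj₂ walk
    }
    where
    d = toℕ b ∸ toℕ a
    a+d≡b : toℕ a + d ≡ toℕ b
    a+d≡b = m+[n∸m]≡n (<⇒≤ a<b)
    lands-on-b : vertex (toℕ a + d) ≡ b
    lands-on-b = trans (cong vertex a+d≡b) (vertex-toℕ b)
    walk : Σ (Path G a b) (λ P → Along (toℕ a) d (proj₁ P))
    walk = retarget {toℕ a} {d} (vertex-toℕ a) (trans (cong vertex (reach≡+ (toℕ a) d)) lands-on-b)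
                    (ascend (toℕ a) d) (ascend-unique (toℕ a) d (≤-<-trans d≤n n<m)) (ascend-along (toℕ a) d)

  backward-arc : ∀ a b → toℕ a < toℕ b → let d = toℕ b ∸ toℕ a in
    n ≤ d → (d ≡ n → Even (toℕ b)) → ArcOf a b
  backward-arc a b a<b n≤d d≡n⇒even = record
    { start = toℕ b ; length = m ∸ d
    ; start<m = Fin.toℕ<n b ; length>0 = m<n⇒0<n∸m d<m ; length≤n = ℓ≤n ; half-even = half-even
    ; ends = inj₂ (vertex-toℕ b , trans (cong vertex (+-comm (toℕ b) (m ∸ d))) lands-on-a)
    ; path = proj₁ walk ; along = proj₂ walk
    }
    where
    d = toℕ b ∸ toℕ a
    d<m : d < m
    d<m = ≤-<-trans (m∸n≤m (toℕ b) (toℕ a)) (Fin.toℕ<n b)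
    m∸n≡n : m ∸ n ≡ n
    m∸n≡n = trans (cong (_∸ n) m≡n+n) (m+n∸n≡m n n)
    ℓ≤n : m ∸ d ≤ n
    ℓ≤n = subst (m ∸ d ≤_) m∸n≡n (∸-monoʳ-≤ m n≤d)
    half-even : m ∸ d ≡ n → Even (toℕ b)
    half-even ℓ≡n = d≡n⇒even (begin
      d                ≡⟨ m∸[m∸n]≡n (<⇒≤ d<m) ⟨
      m ∸ (m ∸ d)      ≡⟨ cong (m ∸_) ℓ≡n ⟩
      m ∸ n            ≡⟨ m∸n≡n ⟩
      n                ∎)
      where open ≡-Reasoning
    wraps : m ∸ d + toℕ b ≡ toℕ a + m
    wraps = begin
      m ∸ d + toℕ b            ≡⟨ cong (m ∸ d +_) (m+[n∸m]≡n (<⇒≤ a<b)) ⟨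
      m ∸ d + (toℕ a + d)      ≡⟨ exchange (m ∸ d) (toℕ a) d ⟩
      toℕ a + (m ∸ d + d)      ≡⟨ cong (toℕ a +_) (m∸n+n≡m (<⇒≤ d<m)) ⟩
      toℕ a + m                ∎
      where
      open ≡-Reasoning
      exchange : ∀ x y z → x + (y + z) ≡ y + (x + z)
      exchange = solve-∀
    lands-on-a : vertex (m ∸ d + toℕ b) ≡ a
    lands-on-a = trans (cong vertex wraps) (trans (vertex-+m (toℕ a)) (vertex-toℕ a))
    walk : Σ (Path G a b) (λ P → Along (toℕ b) (m ∸ d) (proj₁ P))
    walk = retarget {toℕ b} {m ∸ d} lands-on-a (vertex-toℕ b) (descend (toℕ b) (m ∸ d))
                    (descend-unique (toℕ b) (m ∸ d) (≤-<-trans ℓ≤n n<m)) (descend-along (toℕ b) (m ∸ d))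

  -- A shortest arc; an antipodal pair is joined along the half starting at its even end.
  arc-between : ∀ a b → toℕ a < toℕ b → ArcOf a b
  arc-between a b a<b with toℕ b ∸ toℕ a <? n | toℕ b ∸ toℕ a ≟ n
  ... | yes d<n | _ = forward-arc a b a<b (<⇒≤ d<n) (λ d≡n → contradiction d≡n (<⇒≢ d<n))
  ... | no d≮n | no d≢n = backward-arc a b a<b (≮⇒≥ d≮n) (λ d≡n → contradiction d≡n d≢n)
  ... | no _ | yes d≡n with parity (toℕ a)
  ...   | even q a≡2q = forward-arc a b a<b (≤-reflexive d≡n) (λ _ → q , a≡2q)
  ...   | odd q a≡2q+1 = backward-arc a b a<b (≤-reflexive (sym d≡n)) (λ _ → suc (q + h) , b-even)
    where
    b-even : toℕ b ≡ 2 * suc (q + h)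
    b-even = trans (sym (m+[n∸m]≡n (<⇒≤ a<b))) (trans (cong (toℕ a +_) d≡n) (odd+n a≡2q+1))

  -- A colour class consists of the segments of its layout shifted by its rotation, an arc (s , ℓ)
  -- being the edges s, …, s + ℓ - 1 (mod m). Antipodal colours also carry the arcs of lengths 1
  -- and n - 1 filling the other half of the cycle; the remaining arcs of these lengths go to the
  -- paired and leftover colours, the only ones that leave edges unused.
  data Colour : Set where
    antipodal : Fin n → Colour
    paired    : Fin h → Colour
    leftover  : Colour
    tiling    : Fin h′ → Fin n → Colour

  rotation : Colour → ℕ
  rotation (antipodal u) = 2 * toℕ u
  rotation (paired j)    = suc (2 * toℕ j)
  rotation leftover      = n
  rotation (tiling _ u)  = 2 * toℕ u

  halfLayout : ℕ → Layout
  halfLayout f = cut n (λ _ → (0 , f)) (cut (suc n) (λ _ → (n , 1)) (λ _ → (suc n , 2 * h)))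

  tilingLayout : ℕ → Layout
  tilingLayout d = cut d (λ _ → (0 , d))
                  (cut n (λ _ → (d , n ∸ d))
                  (cut (n + d) (λ _ → (n , d)) (λ _ → (n + d , n ∸ d))))

  layout : Colour → Layout
  layout (antipodal _) = halfLayout n
  layout (paired _)    = halfLayout (2 * h)
  layout leftover      = cut n (λ _ → (0 , 2 * h)) (λ y → (y , 1))
  layout (tiling i _)  = tilingLayout (2 + toℕ i)

  private
    2*<n⇒≤m : ∀ {x} → x < n → 2 * x ≤ m
    2*<n⇒≤m x<n = *-monoʳ-≤ 2 (<⇒≤ x<n)

  rotation≤m : ∀ c → rotation c ≤ m
  rotation≤m (antipodal u) = 2*<n⇒≤m (Fin.toℕ<n u)
  rotation≤m (paired j)    = ≤-trans (s≤s (*-monoʳ-≤ 2 (<⇒≤ (Fin.toℕ<n j)))) (<⇒≤ n<m)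
  rotation≤m leftover      = <⇒≤ n<m
  rotation≤m (tiling _ u)  = 2*<n⇒≤m (Fin.toℕ<n u)

  record Placement (c : Colour) (s ℓ : ℕ) : Set where
    field
      offset  : ℕ
      lands   : (rotation c + offset) % m ≡ s
      fits    : offset + ℓ ≤ m
      covered : Covers (layout c) offset ℓ

  absolute : Colour → Segment → ℕ × ℕ
  absolute c (o , ℓ) = ((rotation c + o) % m , ℓ)

  owner : Colour → Fin m → ℕ × ℕ
  owner c x = absolute c (layout c ((toℕ x + (m ∸ rotation c)) % m))

  owner-placement : ∀ {c s ℓ} → Placement c s ℓ → ∀ {j} → j < ℓ → owner c (vertex (s + j)) ≡ (s , ℓ)
  owner-placement {c} {s} {ℓ} P {j} j<ℓ =
    trans (cong (absolute c) (trans (cong (layout c) relative) (covered j j<ℓ))) (cong (_, ℓ) lands)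
    where
    open Placement P
    r = rotation c
    o = offset
    rearrange : ∀ r o j k → r + o + (j + k) ≡ o + j + (r + k)
    rearrange = solve-∀
    relative : (toℕ (vertex (s + j)) + (m ∸ r)) % m ≡ o + j
    relative = begin
      (toℕ (vertex (s + j)) + (m ∸ r)) % m    ≡⟨ cong (λ x → (x + (m ∸ r)) % m) (toℕ-vertex (s + j)) ⟩
      ((s + j) % m + (m ∸ r)) % m             ≡⟨ %-absorbˡ (s + j) (m ∸ r) ⟩
      (s + j + (m ∸ r)) % m                   ≡⟨ cong (_% m) (+-assoc s j (m ∸ r)) ⟩
      (s + (j + (m ∸ r))) % m                 ≡⟨ cong (λ x → (x + (j + (m ∸ r))) % m) lands ⟨
      ((r + o) % m + (j + (m ∸ r))) % m       ≡⟨ %-absorbˡ (r + o) (j + (m ∸ r)) ⟩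
      (r + o + (j + (m ∸ r))) % m             ≡⟨ cong (_% m) (rearrange r o j (m ∸ r)) ⟩
      (o + j + (r + (m ∸ r))) % m             ≡⟨ cong (λ x → (o + j + x) % m) (m+[n∸m]≡n (rotation≤m c)) ⟩
      (o + j + m) % m                         ≡⟨ [m+n]%n≡m%n (o + j) m ⟩
      (o + j) % m                             ≡⟨ m<n⇒m%n≡m (<-≤-trans (+-monoʳ-< o j<ℓ) fits) ⟩
      o + j                                   ∎
      where open ≡-Reasoning

  even-rotation : ∀ {s o q} → s < m → o ≤ m → s + o ≡ 2 * q → Σ (Fin n) λ u → (2 * toℕ u + o) % m ≡ s
  even-rotation {s} {o} {q} s<m o≤m s+o≡2q = fromℕ< u<n , (begin
    (2 * toℕ (fromℕ< u<n) + o) % m   ≡⟨ cong (λ x → (2 * x + o) % m) (Fin.toℕ-fromℕ< u<n) ⟩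
    (2 * (w / 2) + o) % m            ≡⟨ cong (λ x → (x + o) % m) 2*[w/2]≡w ⟩
    (w + o) % m                      ≡⟨ %-absorbˡ (s + (m ∸ o)) o ⟩
    (s + (m ∸ o) + o) % m            ≡⟨ cong (_% m) (trans (+-assoc s (m ∸ o) o) (cong (s +_) (m∸n+n≡m o≤m))) ⟩
    (s + m) % m                      ≡⟨ trans ([m+n]%n≡m%n s m) (m<n⇒m%n≡m s<m) ⟩
    s                                ∎)
    where
    open ≡-Reasoning
    w = (s + (m ∸ o)) % m
    2∣2o+w′ : 2 ∣ 2 * o + (s + (m ∸ o))
    2∣2o+w′ = divides (q + n) (begin
      2 * o + (s + (m ∸ o))      ≡⟨ regroup o s (m ∸ o) ⟩
      (s + o) + ((m ∸ o) + o)    ≡⟨ cong₂ _+_ s+o≡2q (m∸n+n≡m o≤m) ⟩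
      2 * q + 2 * n              ≡⟨ double q n ⟩
      (q + n) * 2                ∎)
      where
      regroup : ∀ o s k → 2 * o + (s + k) ≡ (s + o) + (k + o)
      regroup = solve-∀
      double : ∀ q n → 2 * q + 2 * n ≡ (q + n) * 2
      double = solve-∀
    2∣w : 2 ∣ w
    2∣w = %-presˡ-∣ (∣m+n∣m⇒∣n 2∣2o+w′ (divides o (*-comm 2 o))) (divides n (*-comm 2 n))
    2*[w/2]≡w : 2 * (w / 2) ≡ w
    2*[w/2]≡w = m*[n/m]≡n 2∣w
    u<n : w / 2 < n
    u<n = *-cancelˡ-< 2 (w / 2) n (subst (_< 2 * n) (sym 2*[w/2]≡w) (m%n<n (s + (m ∸ o)) m))

  half-first : ∀ {f} → f ≤ n → Covers (halfLayout f) 0 f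
  half-first {f} f≤n = covers-cutˡ f≤n (covers-const 0 f)

  half-unit : ∀ {f} → Covers (halfLayout f) n 1
  half-unit = covers-cutʳ ≤-refl (covers-cutˡ (≤-reflexive (+-comm n 1)) (covers-const n 1))

  half-last : ∀ {f} → Covers (halfLayout f) (suc n) (2 * h)
  half-last = covers-cutʳ (n≤1+n n) (covers-cutʳ ≤-refl (covers-const (suc n) (2 * h)))

  module _ {d : ℕ} (d≤n : d ≤ n) where

    tiling-first : Covers (tilingLayout d) 0 d
    tiling-first = covers-cutˡ ≤-refl (covers-const 0 d)

    tiling-second : Covers (tilingLayout d) d (n ∸ d)
    tiling-second = covers-cutʳ ≤-refl (covers-cutˡ (≤-reflexive (m+[n∸m]≡n d≤n)) (covers-const d (n ∸ d)))

    tiling-third : Covers (tilingLayout d) n d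
    tiling-third = covers-cutʳ d≤n (covers-cutʳ ≤-refl (covers-cutˡ ≤-refl (covers-const n d)))

    tiling-fourth : Covers (tilingLayout d) (n + d) (n ∸ d)
    tiling-fourth = covers-cutʳ (m≤n+m d n) (covers-cutʳ (m≤m+n n d) (covers-cutʳ ≤-refl (covers-const (n + d) (n ∸ d))))

  Coloured : ℕ → ℕ → Set
  Coloured s ℓ = Σ Colour λ c → Placement c s ℓ

  private
    fits⇒≤m : ∀ {o ℓ} → o + ℓ ≤ m → o ≤ m
    fits⇒≤m {o} {ℓ} fits = ≤-trans (m≤m+n o ℓ) fits

  at-antipodal : ∀ {s o ℓ} q → s < m → s + o ≡ 2 * q → o + ℓ ≤ m → Covers (halfLayout n) o ℓ → Coloured s ℓ
  at-antipodal {s} {o} {ℓ} q s<m s+o≡2q fits cov with even-rotation {s} {o} {q} s<m (fits⇒≤m {ℓ = ℓ} fits) s+o≡2q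
  ... | u , lands = antipodal u , record { lands = lands ; fits = fits ; covered = cov }

  at-tiling : ∀ {s o ℓ} (i : Fin h′) q → s < m → s + o ≡ 2 * q → o + ℓ ≤ m →
              Covers (tilingLayout (2 + toℕ i)) o ℓ → Coloured s ℓ
  at-tiling {s} {o} {ℓ} i q s<m s+o≡2q fits cov with even-rotation {s} {o} {q} s<m (fits⇒≤m {ℓ = ℓ} fits) s+o≡2q
  ... | u , lands = tiling i u , record { lands = lands ; fits = fits ; covered = cov }

  at-paired : ∀ {s o ℓ j} → j < h → suc (2 * j) + o ≡ s → s < m → o + ℓ ≤ m →
              Covers (halfLayout (2 * h)) o ℓ → Coloured s ℓ
  at-paired {s} {o} j<h eq s<m fits cov = paired (fromℕ< j<h) , record
    { lands = trans (cong (λ x → (suc (2 * x) + o) % m) (Fin.toℕ-fromℕ< j<h))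
                    (trans (cong (_% m) eq) (m<n⇒m%n≡m s<m))
    ; fits = fits ; covered = cov }

  private
    half<n : ∀ {s q} → s < m → 2 * q ≤ s → q < n
    half<n {s} {q} s<m 2q≤s = *-cancelˡ-< 2 q n (≤-<-trans 2q≤s s<m)

    even+1+n : ∀ {s q} → s ≡ 2 * q → s + suc n ≡ 2 * suc (q + h)
    even+1+n {q = q} refl = regroup q h
      where
      regroup : ∀ q h → 2 * q + suc (suc (2 * h)) ≡ 2 * suc (q + h)
      regroup = solve-∀

    upper-half : ∀ {q} → h < q → q < n → ∃[ j ] j < h × suc h + j ≡ q
    upper-half {q} h<q q<n = q ∸ suc h , j<h , m+[n∸m]≡n h<q
      where
      j<h : q ∸ suc h < h
      j<h = +-cancelˡ-< (suc h) (q ∸ suc h) h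
              (subst (_< suc (h + h)) (sym (m+[n∸m]≡n h<q)) (subst (q <_) (cong suc (cong (h +_) (+-identityʳ h))) q<n))

    tiling-index : ∀ {d} → 2 ≤ d → d ≤ h → Σ (Fin h′) λ i → 2 + toℕ i ≡ d
    tiling-index {suc (suc k)} (s≤s (s≤s z≤n)) (s≤s k<h′) = fromℕ< k<h′ , cong (λ x → suc (suc x)) (Fin.toℕ-fromℕ< k<h′)

    n+1≤m : n + 1 ≤ m
    n+1≤m = subst (_≤ m) (+-comm 1 n) n<m

    1+n+2h≡m : suc n + 2 * h ≡ m
    1+n+2h≡m = trans (sym (+-suc n (2 * h))) (sym m≡n+n)

    2h≤m : 2 * h ≤ m
    2h≤m = ≤-trans (n≤1+n (2 * h)) (<⇒≤ n<m)

    h≤n : h ≤ n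
    h≤n = ≤-trans (m≤m+n h (h + 0)) (n≤1+n (2 * h))

    n+≤m : ∀ {x} → x ≤ n → n + x ≤ m
    n+≤m {x} x≤n = subst (n + x ≤_) (sym m≡n+n) (+-monoʳ-≤ n x≤n)

  full-arc : ∀ {s} → s < m → Even s → Coloured s n
  full-arc {s} s<m (q , s≡2q) = at-antipodal q s<m (trans (+-identityʳ s) s≡2q) (<⇒≤ n<m) (half-first ≤-refl)

  unit-arc : ∀ {s} → s < m → Coloured s 1
  unit-arc {s} s<m with parity s
  ... | odd q s≡2q+1 = at-antipodal (suc (q + h)) s<m (odd+n s≡2q+1) n+1≤m half-unit
  ... | even q s≡2q with s <? n
  ...   | yes s<n = leftover , record
    { offset = n + s
    ; lands = trans (cong (_% m) wraps) (trans ([m+n]%n≡m%n s m) (m<n⇒m%n≡m s<m))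
    ; fits = subst₂ _≤_ (+-comm 1 (n + s)) (sym m≡n+n) (+-monoʳ-< n s<n)
    ; covered = covers-cutʳ (m≤m+n n s) (covers-unit (n + s)) }
    where
    wraps : n + (n + s) ≡ s + m
    wraps = trans (sym (+-assoc n n s)) (trans (+-comm (n + n) s) (cong (s +_) (sym m≡n+n)))
  ...   | no s≮n with upper-half h<q (half<n s<m (≤-reflexive (sym s≡2q)))
    where
    h<q : h < q
    h<q = ≰⇒> λ q≤h → s≮n (subst (_< n) (sym s≡2q) (s≤s (*-monoʳ-≤ 2 q≤h)))
  ...     | j , j<h , refl = at-paired j<h (trans (lands-above j) (sym s≡2q)) s<m n+1≤m half-unit
    where
    lands-above : ∀ j → suc (2 * j) + n ≡ 2 * (suc h + j)
    lands-above j = regroup j h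
      where
      regroup : ∀ j h → suc (2 * j) + suc (2 * h) ≡ 2 * (suc h + j)
      regroup = solve-∀

  near-full-arc : ∀ {s} → s < m → Coloured s (2 * h)
  near-full-arc {s} s<m with parity s
  ... | even q s≡2q = at-antipodal (suc (q + h)) s<m (even+1+n s≡2q) (≤-reflexive 1+n+2h≡m) half-last
  ... | odd q s≡2q+1 with <-cmp q h
  ...   | tri< q<h _ _ = at-paired q<h (trans (+-identityʳ _) (sym s≡2q+1)) s<m 2h≤m (half-first (n≤1+n (2 * h)))
  ...   | tri≈ _ refl _ = leftover , record
    { offset = 0
    ; lands = trans (cong (_% m) (+-identityʳ n)) (trans (m<n⇒m%n≡m n<m) (sym s≡2q+1))
    ; fits = 2h≤m
    ; covered = covers-cutˡ (n≤1+n (2 * h)) (covers-const 0 (2 * h)) }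
  ...   | tri> _ _ h<q with upper-half h<q (half<n s<m (≤-trans (n≤1+n (2 * q)) (≤-reflexive (sym s≡2q+1))))
  ...     | j , j<h , refl = at-paired j<h (trans (lands-above j) (sym s≡2q+1)) s<m (≤-reflexive 1+n+2h≡m) half-last
    where
    lands-above : ∀ j → suc (2 * j) + suc n ≡ suc (2 * (suc h + j))
    lands-above j = regroup j h
      where
      regroup : ∀ j h → suc (2 * j) + suc (suc (2 * h)) ≡ suc (2 * (suc h + j))
      regroup = solve-∀

  short-arc : ∀ {s ℓ} → s < m → 2 ≤ ℓ → ℓ ≤ h → Coloured s ℓ
  short-arc {s} {ℓ} s<m 2≤ℓ ℓ≤h with tiling-index 2≤ℓ ℓ≤h | parity s
  ... | i , refl | even q s≡2q =
    at-tiling i q s<m (trans (+-identityʳ s) s≡2q) (≤-trans ℓ≤n (<⇒≤ n<m)) (tiling-first ℓ≤n)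
    where ℓ≤n = ≤-trans ℓ≤h h≤n
  ... | i , refl | odd q s≡2q+1 =
    at-tiling i (suc (q + h)) s<m (odd+n s≡2q+1) (n+≤m ℓ≤n) (tiling-third ℓ≤n)
    where ℓ≤n = ≤-trans ℓ≤h h≤n

  long-arc : ∀ {s ℓ} → s < m → h < ℓ → ℓ < 2 * h → Coloured s ℓ
  long-arc {s} {ℓ} s<m h<ℓ ℓ<2h = place (tiling-index 2≤d d≤h) (parity (s + d))
    where
    d = n ∸ ℓ
    2≤d : 2 ≤ d
    2≤d = subst (_≤ d) (m+n∸m≡n ℓ 2) (∸-monoˡ-≤ ℓ (subst (_≤ n) (+-comm 2 ℓ) (s≤s ℓ<2h)))
    d≤h : d ≤ h
    d≤h = subst (d ≤_) (trans (m+n∸m≡n h (h + 0)) (+-identityʳ h)) (∸-monoʳ-≤ n h<ℓ)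
    d≤n : d ≤ n
    d≤n = m∸n≤m n ℓ
    ℓ≤n : ℓ ≤ n
    ℓ≤n = ≤-trans (<⇒≤ ℓ<2h) (n≤1+n (2 * h))
    d+ℓ≡n : d + ℓ ≡ n
    d+ℓ≡n = m∸n+n≡m ℓ≤n
    n+d+ℓ≡m : n + d + ℓ ≡ m
    n+d+ℓ≡m = trans (+-assoc n d ℓ) (trans (cong (n +_) d+ℓ≡n) (sym m≡n+n))
    as-tiling-segment : ∀ {i o} → 2 + toℕ i ≡ d → Covers (tilingLayout d) o (n ∸ d) →
                        Covers (tilingLayout (2 + toℕ i)) o ℓ
    as-tiling-segment {o = o} 2+i≡d = subst₂ (λ e k → Covers (tilingLayout e) o k) (sym 2+i≡d) (m∸[m∸n]≡n ℓ≤n)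
    shift : ∀ s d n → s + (n + d) ≡ s + d + n
    shift = solve-∀
    place : Σ (Fin h′) (λ i → 2 + toℕ i ≡ d) → Parity (s + d) → Coloured s ℓ
    place (i , 2+i≡d) (even q s+d≡2q) =
      at-tiling i q s<m s+d≡2q (≤-trans (≤-reflexive d+ℓ≡n) (<⇒≤ n<m))
                (as-tiling-segment 2+i≡d (tiling-second d≤n))
    place (i , 2+i≡d) (odd q s+d≡2q+1) =
      at-tiling i (suc (q + h)) s<m (trans (shift s d n) (odd+n s+d≡2q+1)) (≤-reflexive n+d+ℓ≡m)
                (as-tiling-segment 2+i≡d (tiling-fourth d≤n))

  classify : ∀ {s ℓ} → s < m → 0 < ℓ → ℓ ≤ n → (ℓ ≡ n → Even s) → Coloured s ℓ
  classify {s} {ℓ} s<m ℓ>0 ℓ≤n half-even with ℓ ≟ n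
  ... | yes refl = full-arc s<m (half-even refl)
  ... | no ℓ≢n with ℓ ≟ 1
  ...   | yes refl = unit-arc s<m
  ...   | no ℓ≢1 with ℓ ≟ 2 * h
  ...     | yes refl = near-full-arc s<m
  ...     | no ℓ≢2h with ℓ ≤? h
  ...       | yes ℓ≤h = short-arc s<m (≤∧≢⇒< ℓ>0 (ℓ≢1 ∘ sym)) ℓ≤h
  ...       | no ℓ≰h = long-arc s<m (≰⇒> ℓ≰h) (≤∧≢⇒< (s≤s⁻¹ (≤∧≢⇒< ℓ≤n ℓ≢n)) ℓ≢2h)

  K : ℕ
  K = n + (h + suc (h′ * n))

  K+K≡n²+1 : K + K ≡ n * n + 1
  K+K≡n²+1 = count h′
    where
    count : ∀ h′ → let h = suc h′ ; n = suc (2 * h) in (n + (h + suc (h′ * n))) + (n + (h + suc (h′ * n))) ≡ n * n + 1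
    count = solve-∀

  encode : Colour → Fin K
  encode (antipodal u) = u ↑ˡ (h + suc (h′ * n))
  encode (paired j)    = n ↑ʳ (j ↑ˡ suc (h′ * n))
  encode leftover      = n ↑ʳ (h ↑ʳ zero)
  encode (tiling i u)  = n ↑ʳ (h ↑ʳ suc (combine i u))

  decode : Fin K → Colour
  decode k with splitAt n k
  ... | inj₁ u = antipodal u
  ... | inj₂ r with splitAt h r
  ...   | inj₁ j = paired j
  ...   | inj₂ zero = leftover
  ...   | inj₂ (suc c) = uncurry tiling (remQuot n c)

  decode-encode : ∀ c → decode (encode c) ≡ c
  decode-encode (antipodal u) rewrite Fin.splitAt-↑ˡ n u (h + suc (h′ * n)) = refl
  decode-encode (paired j)
    rewrite Fin.splitAt-↑ʳ n (h + suc (h′ * n)) (j ↑ˡ suc (h′ * n)) | Fin.splitAt-↑ˡ h j (suc (h′ * n)) = refl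
  decode-encode leftover
    rewrite Fin.splitAt-↑ʳ n (h + suc (h′ * n)) (h ↑ʳ zero) | Fin.splitAt-↑ʳ h (suc (h′ * n)) zero = refl
  decode-encode (tiling i u)
    rewrite Fin.splitAt-↑ʳ n (h + suc (h′ * n)) (h ↑ʳ suc (combine i u))
          | Fin.splitAt-↑ʳ h (suc (h′ * n)) (suc (combine i u)) = cong (uncurry tiling) (Fin.remQuot-combine i u)

  arc : (p : Pair G) → ArcOf (proj₁ (proj₁ p)) (proj₂ (proj₁ p))
  arc ((a , b) , a<b) = arc-between a b a<b

  arc-system : PathSystem G
  arc-system p = ArcOf.path (arc p)

  colouring : (p : Pair G) → Coloured (ArcOf.start (arc p)) (ArcOf.length (arc p))
  colouring p = classify start<m length>0 length≤n half-even
    where open ArcOf (arc p)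

  arc-packing : GlobalPacking G arc-system K
  arc-packing = encode ∘ colour , disjoint
    where
    colour : Pair G → Colour
    colour p = proj₁ (colouring p)
    owns : ∀ p {j} → j < ArcOf.length (arc p) →
           owner (colour p) (vertex (ArcOf.start (arc p) + j)) ≡ (ArcOf.start (arc p) , ArcOf.length (arc p))
    owns p = owner-placement (proj₂ (colouring p))
    disjoint : ∀ p q → proj₁ p ≢ proj₁ q → ShareEdge G (arc-system p) (arc-system q) →
               encode (colour p) ≢ encode (colour q)
    disjoint p q p≢q (u , u′ , uu′∈p , uu′∈q) same-code = p≢q
      (ArcOf-injective (proj₂ p) (proj₂ q) (arc p) (arc q) (cong proj₁ same-arc) (cong proj₂ same-arc))
      where
      same-colour : colour p ≡ colour q
      same-colour = trans (sym (decode-encode (colour p))) (trans (cong decode same-code) (decode-encode (colour q)))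
      edge-in-q : (u , u′) ∈ edges G (proj₁ (arc-system q)) ⊎ (u′ , u) ∈ edges G (proj₁ (arc-system q)) →
                  ∃[ j ] j < ArcOf.length (arc q) × EdgeAt (vertex (ArcOf.start (arc q) + j)) u u′
      edge-in-q (inj₁ uu′∈) = ArcOf.along (arc q) uu′∈
      edge-in-q (inj₂ u′u∈) with ArcOf.along (arc q) u′u∈
      ... | j , j<ℓ , at = j , j<ℓ , EdgeAt-swap at
      same-arc : (ArcOf.start (arc p) , ArcOf.length (arc p)) ≡ (ArcOf.start (arc q) , ArcOf.length (arc q))
      same-arc with ArcOf.along (arc p) uu′∈p | edge-in-q uu′∈q
      ... | j , j<ℓ , at-p | j′ , j′<ℓ′ , at-q =
        trans (sym (owns p j<ℓ)) (trans (cong₂ owner same-colour (EdgeAt-unique at-p at-q)) (owns q j′<ℓ′))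

  private
    length-sum : PathSystem G → ℕ
    length-sum 𝒫 = ∑ᴾ (λ p → len G (proj₁ (𝒫 p)))

    n³≤length-sum : ∀ 𝒫 → n * n * n ≤ length-sum 𝒫
    n³≤length-sum 𝒫 = subst (_≤ length-sum 𝒫) (∑ᴾ-cdist {n} m≡n+n) (∑ᴾ-mono-≤ λ p → cdist≤len (proj₁ (𝒫 p)))

    m*[K+K] : m * (K + K) ≡ n * n * n + n * n * n + m
    m*[K+K] = trans (cong (m *_) K+K≡n²+1) (expand n)
      where
      expand : ∀ n → 2 * n * (n * n + 1) ≡ n * n * n + n * n * n + 2 * n
      expand = solve-∀

  packing-needs-K : ∀ 𝒫 {k} → GlobalPacking G 𝒫 k → K ≤ k
  packing-needs-K 𝒫 {k} packing = +-double-cancel-≤ (*-cancelˡ-≤ m (begin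
    m * (K + K)                              ≡⟨ m*[K+K] ⟩
    n * n * n + n * n * n + m                ≤⟨ +-monoˡ-≤ m (+-mono-≤ (n³≤length-sum 𝒫) (n³≤length-sum 𝒫)) ⟩
    length-sum 𝒫 + length-sum 𝒫 + m         ≤⟨ PackingBound.∑ᴾ-length-bound {𝒫} {k} packing {n} m≡n+n ⟩
    m * (k + k)                              ∎))
    where open ≤-Reasoning

  arc-system-Φ≡K : PhiSys≡ G arc-system K
  arc-system-Φ≡K = arc-packing , λ _ packing → packing-needs-K arc-system packing

  ideal⇒shortest : ∀ 𝒫 → Ideal G 𝒫 → ShortestPathSystem G 𝒫
  ideal⇒shortest 𝒫 (k , (packing , _) , (_ , Φ-minimal)) p Q =
    ≤-trans (∑ᴾ-tight (λ q → cdist≤len (walk q)) length-sum≤∑cdist p) (cdist≤len (proj₁ Q))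
    where
    walk : (q : Pair G) → Walk G (proj₁ (proj₁ q)) (proj₂ (proj₁ q))
    walk q = proj₁ (𝒫 q)
    k≤K : k ≤ K
    k≤K = Φ-minimal K (arc-system , arc-system-Φ≡K)
    length-sum≤∑cdist : length-sum 𝒫 ≤ ∑ᴾ (λ q → cdist (toℕ (proj₁ (proj₁ q))) (toℕ (proj₂ (proj₁ q))))
    length-sum≤∑cdist = subst (length-sum 𝒫 ≤_) (sym (∑ᴾ-cdist {n} m≡n+n)) (+-double-cancel-≤ (+-cancelʳ-≤ m _ _ (begin
      length-sum 𝒫 + length-sum 𝒫 + m         ≤⟨ PackingBound.∑ᴾ-length-bound {𝒫} {k} packing {n} m≡n+n ⟩
      m * (k + k)                              ≤⟨ *-monoʳ-≤ m (+-mono-≤ k≤K k≤K) ⟩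
      m * (K + K)                              ≡⟨ m*[K+K] ⟩
      n * n * n + n * n * n + m                ∎)))
      where open ≤-Reasoning

corollary1 : (n : ℕ) → (∃[ t ] n ≡ suc (2 * t)) → 1 < n →
    (𝒫 : PathSystem (C (2 * n))) → Ideal (C (2 * n)) 𝒫 → Perfect (C (2 * n)) 𝒫
corollary1 n (zero , refl) (s≤s ())
corollary1 n (suc h′ , refl) _ 𝒫 ideal = ideal , Construction.ideal⇒shortest h′ 𝒫 ideal
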